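{- For any $\Delta, k \in \mathbb{N}$ and $\xi > 0$ there exist $\lambda>0$, $\beta > 0$ and $n_0 \in \mathbb{N}$ such that the following holds. Let $H$ be a bipartite graph on $n \geq n_0$ vertices with bandwidth at most $\beta n$ and $\Delta(H) \leq \Delta$. Let $n_1, \dots, n_{2k}$ be an integer partition of $n$ with $n_i > n/(3k)$ for all $1 \le i \le 2k$ and $|n_{2i-1} - n_{2i}| \le \lambda n$ for all $1 \le i \le k$. Let $C$ be the cycle $1 2 \dots (2k) 1$ on vertex set $[2k]$, and let $c = \{2i_1, 2i_2\}$ be a chord of $C$ for some distinct $1 \le i_1, i_2 \le k$. Then there exist a set $S \subseteq V(H)$ and a graph homomorphism $f : H \to C \cup \{c\}$ such that ($\beta_1$) $|S| \leq \xi n$; ($\beta_2$) $|f^{ -1}(i)| \leq n_i + \xi n$ for all $1 \le i \le 2k$; ($\beta_3$) every edge of $H$ which is not in $H[S]$ is mapped to an edge $\{2i-1, 2i\}$ for some $1 \le i \le k$.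
   Context: $H$ on $n$ vertices has bandwidth at most $b$ if its vertices can be labelled $1,\dots,n$ with $|i-j|\le b$ for every edge $ij$. $C\cup\{c\}$ denotes the graph obtained from the cycle $C$ by adding the edge $c$. A graph homomorphism maps vertices to vertices so that edges go to edges.
   Formalization: The parameter ξ ranges over the positive rationals, and the witnesses λ and β are taken in the rationals. -}

module Defs where

open import Data.Bool using (Bool; true; false; _∧_)
open import Data.Nat using (ℕ; zero; suc; _+_; _*_; _≤_; _<_; ∣_-_∣)
open import Data.Fin using (Fin; toℕ) renaming (zero to fzero; suc to fsuc)
open import Data.Integer using (+_)
open import Data.Rational using (ℚ; _/_) renaming (_≤_ to _≤ℚ_; _*_ to _*ℚ_)
open import Data.Product using (Σ; ∃; _×_; _,_)
open import Data.Sum using (_⊎_)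
open import Relation.Binary.PropositionalEquality using (_≡_; _≢_)
open import Function.Definitions using (Injective)
open import Relation.Nullary.Decidable using (⌊_⌋)
open import Data.Fin using (_≟_)

toℚ : ℕ → ℚ
toℚ n = (+ n) / 1

countF : {n : ℕ} → (Fin n → Bool) → ℕ
countF {zero} p = 0
countF {suc n} p with p fzero
... | true  = suc (countF (λ i → p (fsuc i)))
... | false = countF (λ i → p (fsuc i))

sumF : {n : ℕ} → (Fin n → ℕ) → ℕ
sumF {zero} f = 0
sumF {suc n} f = f fzero + sumF (λ i → f (fsuc i))

record Graph (n : ℕ) : Set where
  field
    adj     : Fin n → Fin n → Bool
    sym     : ∀ u v → adj u v ≡ adj v u
    irrefl  : ∀ u → adj u u ≡ false

open Graph public

Edge : {n : ℕ} → Graph n → Fin n → Fin n → Set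
Edge H u v = adj H u v ≡ true

degree : {n : ℕ} → Graph n → Fin n → ℕ
degree H u = countF (adj H u)

MaxDegreeAtMost : {n : ℕ} → Graph n → ℕ → Set
MaxDegreeAtMost H Δ = ∀ u → degree H u ≤ Δ

Bipartite : {n : ℕ} → Graph n → Set
Bipartite {n} H = Σ (Fin n → Bool) λ col → ∀ u v → Edge H u v → col u ≢ col v

-- bandwidth at most b (b rational): a labelling (bijection Fin n → Fin n,
-- injectivity suffices on a finite set) with |σ u - σ v| ≤ b for every edge
BandwidthAtMost : {n : ℕ} → Graph n → ℚ → Set
BandwidthAtMost {n} H b =
  Σ (Fin n → Fin n) λ σ → Injective _≡_ _≡_ σ ×
    (∀ u v → Edge H u v → toℚ ∣ toℕ (σ u) - toℕ (σ v) ∣ ≤ℚ b)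

-- Vertex set [2k] = {1,…,2k} is represented by Fin (2 * k) with vertex j ↦ toℕ j = j - 1.
-- Cycle C = 1 2 … (2k) 1 : 0-based vertices i, j adjacent iff j ≡ i+1 mod 2k.
CycleAdj : (k : ℕ) → Fin (2 * k) → Fin (2 * k) → Set
CycleAdj k i j =
  suc (toℕ i) ≡ toℕ j ⊎ suc (toℕ j) ≡ toℕ i ⊎
  (suc (toℕ i) ≡ 2 * k × toℕ j ≡ 0) ⊎ (suc (toℕ j) ≡ 2 * k × toℕ i ≡ 0)

-- chord c = {2 i₁, 2 i₂} with i₁ = a + 1, i₂ = b + 1 (a b : Fin k);
-- 0-based endpoints 2a+1 and 2b+1
ChordAdj : (k : ℕ) → Fin k → Fin k → Fin (2 * k) → Fin (2 * k) → Set
ChordAdj k a b i j =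
  (toℕ i ≡ suc (2 * toℕ a) × toℕ j ≡ suc (2 * toℕ b)) ⊎
  (toℕ j ≡ suc (2 * toℕ a) × toℕ i ≡ suc (2 * toℕ b))

CycleChordAdj : (k : ℕ) → Fin k → Fin k → Fin (2 * k) → Fin (2 * k) → Set
CycleChordAdj k a b i j = CycleAdj k i j ⊎ ChordAdj k a b i j

IsHom : {n : ℕ} → Graph n → (k : ℕ) → Fin k → Fin k → (Fin n → Fin (2 * k)) → Set
IsHom {n} H k a b f = ∀ u v → Edge H u v → CycleChordAdj k a b (f u) (f v)

-- {i, j} is one of the edges {2m-1, 2m} (1 ≤ m ≤ k); 0-based {2m', 2m'+1}, m' : Fin k
PairEdge : (k : ℕ) → Fin (2 * k) → Fin (2 * k) → Set
PairEdge k i j = ∃ λ (m : Fin k) →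
  (toℕ i ≡ 2 * toℕ m × toℕ j ≡ suc (2 * toℕ m)) ⊎
  (toℕ j ≡ 2 * toℕ m × toℕ i ≡ suc (2 * toℕ m))

preimageSize : {n k : ℕ} → (Fin n → Fin (2 * k)) → Fin (2 * k) → ℕ
preimageSize f i = countF (λ v → ⌊ f v ≟ i ⌋)

module Submission where

open import Defs hiding (sym)
open import Data.Bool using (Bool; true; false; _∧_; _∨_; not; T)
open import Data.Bool.Properties using (T-∧; T-∨; T-≡; T-not-≡)
open import Data.Unit using (tt)
open import Data.Empty using (⊥-elim)
open import Data.Nat using (ℕ; zero; suc; _+_; _*_; _∸_; _≤_; _<_; _≥_; z≤n; s≤s; z<s; _≤ᵇ_; _<ᵇ_; _≡ᵇ_; _≤?_; _<?_; ∣_-_∣; ⌊_/2⌋)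
open import Data.Nat.Properties
open import Data.Nat.DivMod using (_/_; _%_; m/n*n≤m; m%n<n; m≡m%n+[m/n]*n)
open import Data.Nat.Tactic.RingSolver using (solve-∀)
open import Data.Fin using (Fin; toℕ; fromℕ<) renaming (zero to fzero; suc to fsuc)
open import Data.Fin using () renaming (_≟_ to _≟ᶠ_)
import Data.Fin.Properties as FinP
open import Data.Product using (Σ; _×_; _,_; proj₁; proj₂)
open import Data.Sum using (_⊎_; inj₁; inj₂; [_,_]′)
open import Function.Bundles using (Equivalence)
open import Function.Definitions using (Injective)
open import Relation.Binary using (tri<; tri≈; tri>)
open import Relation.Binary.PropositionalEquality using (_≡_; _≢_; refl; sym; trans; cong; cong₂; subst; subst₂; module ≡-Reasoning)
open import Relation.Nullary using (¬_; Dec; yes; no)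
open import Relation.Nullary.Decidable using (T?; decidable-stable; toWitness; ⌊_⌋)
import Data.Integer as ℤ
import Data.Integer.Properties as ℤP
open import Data.Integer using (+≤+; +<+)
open import Data.Rational using (ℚ; mkℚ; 0ℚ; toℚᵘ; *<*) renaming (_≤_ to _≤ℚ_; _<_ to _<ℚ_; _*_ to _*ℚ_; _+_ to _+ℚ_)
import Data.Rational.Properties as ℚP
open import Data.Rational.Unnormalised using (mkℚᵘ; *≤*) renaming (_≤_ to _≤ᵘ_; _≃_ to _≃ᵘ_; _*_ to _*ᵘ_; _+_ to _+ᵘ_)
import Data.Rational.Unnormalised.Properties as ℚᵘP
open import Data.Nat.Coprimality using (Coprime; 1-coprimeTo)
import Data.Nat.Coprimality as Coprimality

-- Lemma 8.1 (0-based: target vertices 0, …, 2k - 1, pairs {2q, 2q + 1}, chord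
-- between 2a + 1 and 2b + 1).  Cut the bandwidth ordering of V(H) into blocks of
-- w ≈ n / M consecutive labels; every edge then joins equal or adjacent blocks.
-- Blocks are mapped along a walk in C ∪ {c}: the blocks are split into k regions,
-- region q of about (n_{2q} + n_{2q+1}) / w blocks, where the walk oscillates
-- between 2q and 2q + 1, except for one detour of odd length through the chord,
-- before stepping on to 2q + 2.  A vertex of colour c in block t goes to step t or
-- t + 1 of the walk, whichever has the parity of c, so the ends of an edge go to
-- consecutive steps: f is a homomorphism.  The odd detour swaps the colour
-- classes between 2q and 2q + 1, and a discrete intermediate value theorem places
-- it so that both receive about half of the region.  The exceptional vertices lie
-- next to steps leaving a pair, i.e. near a detour or a region boundary.

T-∧-intro : ∀ {x y} → T x → T y → T (x ∧ y)
T-∧-intro {x} {y} p q = Equivalence.from (T-∧ {x} {y}) (p , q)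

T-∧-fst : ∀ {x y} → T (x ∧ y) → T x
T-∧-fst {x} {y} p = proj₁ (Equivalence.to (T-∧ {x} {y}) p)

T-∧-snd : ∀ {x y} → T (x ∧ y) → T y
T-∧-snd {x} {y} p = proj₂ (Equivalence.to (T-∧ {x} {y}) p)

T-∨-inl : ∀ {x y} → T x → T (x ∨ y)
T-∨-inl {x} {y} p = Equivalence.from (T-∨ {x} {y}) (inj₁ p)

T-∨-inr : ∀ {x y} → T y → T (x ∨ y)
T-∨-inr {x} {y} p = Equivalence.from (T-∨ {x} {y}) (inj₂ p)

T-not-intro : ∀ {x} → ¬ T x → T (not x)
T-not-intro {false} _ = tt
T-not-intro {true}  h = h tt

T-not-elim : ∀ {x} → T (not x) → ¬ T x
T-not-elim {false} _ ()

¬∧-true : ∀ x y → ¬ (x ∧ y ≡ true) → ¬ T x ⊎ ¬ T y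
¬∧-true true  true  h = ⊥-elim (h refl)
¬∧-true true  false h = inj₂ λ ()
¬∧-true false y     h = inj₁ λ ()

countF-mono : ∀ {n} {p q : Fin n → Bool} → (∀ v → T (p v) → T (q v)) → countF p ≤ countF q
countF-mono {zero} h = z≤n
countF-mono {suc n} {p} {q} h with p fzero | q fzero | h fzero
... | true  | true  | _  = s≤s (countF-mono (λ v → h (fsuc v)))
... | true  | false | h0 = ⊥-elim (h0 tt)
... | false | true  | _  = m≤n⇒m≤1+n (countF-mono (λ v → h (fsuc v)))
... | false | false | _  = countF-mono (λ v → h (fsuc v))

countF-cong : ∀ {n} {p q : Fin n → Bool} →
  (∀ v → T (p v) → T (q v)) → (∀ v → T (q v) → T (p v)) → countF p ≡ countF q
countF-cong p⇒q q⇒p = ≤-antisym (countF-mono p⇒q) (countF-mono q⇒p)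

countF-∨ : ∀ {n} (p q : Fin n → Bool) → countF (λ v → p v ∨ q v) ≤ countF p + countF q
countF-∨ {zero} p q = z≤n
countF-∨ {suc n} p q with p fzero | q fzero
... | true  | true  = s≤s (≤-trans (countF-∨ p′ q′) (+-monoʳ-≤ (countF p′) (n≤1+n _)))
  where p′ = λ v → p (fsuc v) ; q′ = λ v → q (fsuc v)
... | true  | false = s≤s (countF-∨ (λ v → p (fsuc v)) (λ v → q (fsuc v)))
... | false | true  = ≤-trans (s≤s (countF-∨ p′ q′)) (≤-reflexive (sym (+-suc (countF p′) _)))
  where p′ = λ v → p (fsuc v) ; q′ = λ v → q (fsuc v)
... | false | false = countF-∨ (λ v → p (fsuc v)) (λ v → q (fsuc v))

countF-split : ∀ {n} (p q : Fin n → Bool) →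
  countF p ≡ countF (λ v → p v ∧ q v) + countF (λ v → p v ∧ not (q v))
countF-split {zero} p q = refl
countF-split {suc n} p q with p fzero | q fzero
... | true  | true  = cong suc (countF-split (λ v → p (fsuc v)) (λ v → q (fsuc v)))
... | true  | false = trans (cong suc (countF-split (λ v → p (fsuc v)) (λ v → q (fsuc v))))
                        (sym (+-suc _ _))
... | false | _     = countF-split (λ v → p (fsuc v)) (λ v → q (fsuc v))

countF-empty : ∀ {n} (p : Fin n → Bool) → (∀ v → ¬ T (p v)) → countF p ≡ 0
countF-empty {zero} p h = refl
countF-empty {suc n} p h with p fzero | h fzero
... | true  | h0 = ⊥-elim (h0 tt)
... | false | _  = countF-empty (λ v → p (fsuc v)) (λ v → h (fsuc v))

countF-≤1 : ∀ {n} (p : Fin n → Bool) → (∀ u v → T (p u) → T (p v) → u ≡ v) → countF p ≤ 1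
countF-≤1 {zero} p h = z≤n
countF-≤1 {suc n} p h with p fzero | h fzero
... | true  | h0 = s≤s (≤-reflexive (countF-empty (λ v → p (fsuc v)) λ v pv → zero≢suc (h0 (fsuc v) tt pv)))
  where
  zero≢suc : ∀ {v : Fin n} → fzero ≢ fsuc v
  zero≢suc ()
... | false | _  = countF-≤1 (λ v → p (fsuc v)) λ u v pu pv → FinP.suc-injective (h (fsuc u) (fsuc v) pu pv)

between : ℕ → ℕ → ℕ → Bool
between a b t = (a ≤ᵇ t) ∧ (t <ᵇ b)

between-intro : ∀ {a b t} → a ≤ t → t < b → T (between a b t)
between-intro a≤t t<b = T-∧-intro (≤⇒≤ᵇ a≤t) (<⇒<ᵇ t<b)

between-lo : ∀ {a b t} → T (between a b t) → a ≤ t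
between-lo {a} {b} {t} h = ≤ᵇ⇒≤ a t (T-∧-fst h)

between-hi : ∀ {a b t} → T (between a b t) → t < b
between-hi {a} {b} {t} h = <ᵇ⇒< t b (T-∧-snd {a ≤ᵇ t} h)

between-mono : ∀ {a b a′ b′ t} → a′ ≤ a → b ≤ b′ → T (between a b t) → T (between a′ b′ t)
between-mono {a} {b} a′≤a b≤b′ h = between-intro (≤-trans a′≤a (between-lo {a} {b} h)) (<-≤-trans (between-hi {a} {b} h) b≤b′)

count-injective-interval : ∀ {n} (g : Fin n → ℕ) → (∀ u v → g u ≡ g v → u ≡ v) →
  ∀ x m → countF (λ v → between x (x + m) (g v)) ≤ m
count-injective-interval g g-inj x zero = ≤-reflexive (countF-empty _ λ v h →
  <-irrefl refl (≤-<-trans (between-lo {x} {x + 0} h) (subst (g v <_) (+-identityʳ x) (between-hi {x} {x + 0} h))))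
count-injective-interval {n} g g-inj x (suc m) = begin
  countF longer                           ≤⟨ countF-mono split ⟩
  countF (λ v → shorter v ∨ last v)       ≤⟨ countF-∨ shorter last ⟩
  countF shorter + countF last            ≤⟨ +-mono-≤ (count-injective-interval g g-inj x m) (countF-≤1 last unique) ⟩
  m + 1                                   ≡⟨ +-comm m 1 ⟩
  suc m                                   ∎
  where
  open ≤-Reasoning
  longer shorter last : Fin n → Bool
  longer v  = between x (x + suc m) (g v)
  shorter v = between x (x + m) (g v)
  last v    = g v ≡ᵇ x + m
  split : ∀ v → T (longer v) → T (shorter v ∨ last v)
  split v h with m≤n⇒m<n∨m≡n (≤-pred (subst (g v <_) (+-suc x m) (between-hi {x} {x + suc m} h)))
  ... | inj₁ lt = T-∨-inl {shorter v} (between-intro (between-lo {x} {x + suc m} h) lt)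
  ... | inj₂ eq = T-∨-inr {shorter v} (≡⇒≡ᵇ _ _ eq)
  unique : ∀ u v → T (last u) → T (last v) → u ≡ v
  unique u v hu hv = g-inj u v (trans (≡ᵇ⇒≡ _ _ hu) (sym (≡ᵇ⇒≡ _ _ hv)))

module Blocks {n : ℕ} (g : Fin n → ℕ) (g-inj : ∀ u v → g u ≡ g v → u ≡ v) (w₀ : ℕ) where

  w : ℕ
  w = suc w₀

  block : Fin n → ℕ
  block v = g v / w

  block-lo : ∀ v → block v * w ≤ g v
  block-lo v = m/n*n≤m (g v) w

  block-hi : ∀ v → g v < suc (block v) * w
  block-hi v = subst (_< suc (block v) * w) (sym (m≡m%n+[m/n]*n (g v) w))
                 (+-monoˡ-< (block v * w) (m%n<n (g v) w))

  count-blocks : ∀ a m → countF (λ v → between a (a + m) (block v)) ≤ m * w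
  count-blocks a m = ≤-trans (countF-mono inLabels) (count-injective-interval g g-inj (a * w) (m * w))
    where
    inLabels : ∀ v → T (between a (a + m) (block v)) → T (between (a * w) (a * w + m * w) (g v))
    inLabels v h = between-intro (≤-trans (*-monoˡ-≤ w (between-lo {a} {a + m} h)) (block-lo v))
      (<-≤-trans (block-hi v) (≤-trans (*-monoˡ-≤ w (between-hi {a} {a + m} h)) (≤-reflexive (*-distribʳ-+ w a m))))

  block-near : ∀ u v → g v < g u + w → block v ≤ suc (block u)
  block-near u v close with block v ≤? suc (block u)
  ... | yes p = p
  ... | no np = ⊥-elim (<-irrefl refl (≤-<-trans far (<-≤-trans close upper)))
    where
    far : suc (suc (block u)) * w ≤ g v
    far = ≤-trans (*-monoˡ-≤ w (≰⇒> np)) (block-lo v)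
    upper : g u + w ≤ suc (suc (block u)) * w
    upper = subst (g u + w ≤_) (+-comm (suc (block u) * w) w) (+-monoˡ-≤ w (<⇒≤ (block-hi u)))

SlowlyVarying : (ℕ → ℕ) → ℕ → ℕ → Set
SlowlyVarying a c J = ∀ j → j < J → a (suc j) ≤ a j + c × a j ≤ a (suc j) + c

discrete-ivt : ∀ (a b : ℕ → ℕ) (c c′ J : ℕ) → c + c ≤ c′ →
  SlowlyVarying a c J → SlowlyVarying b c J → a 0 ≤ b 0 + c′ → b J ≤ a J + c′ →
  Σ ℕ λ j → j ≤ J × a j ≤ b j + c′ × b j ≤ a j + c′
discrete-ivt a b c c′ zero 2c≤c′ sa sb start end = 0 , z≤n , start , end
discrete-ivt a b c c′ (suc J) 2c≤c′ sa sb start end with b 0 ≤? a 0 + c′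
... | yes close = 0 , z≤n , start , close
... | no far with discrete-ivt (λ j → a (suc j)) (λ j → b (suc j)) c c′ J 2c≤c′
                   (λ j j<J → sa (suc j) (s≤s j<J)) (λ j j<J → sb (suc j) (s≤s j<J)) start′ end
  where
  open ≤-Reasoning
  -- a has not yet caught up with b after one step, since b was ahead by more than c′ ≥ 2c.
  start′ : a 1 ≤ b 1 + c′
  start′ = ≤-trans (<⇒≤ (+-cancelʳ-< c′ (a 1) (b 1) (begin-strict
      a 1 + c′       ≤⟨ +-monoˡ-≤ c′ (proj₁ (sa 0 z<s)) ⟩
      a 0 + c + c′   ≡⟨ swap (a 0) c c′ ⟩
      a 0 + c′ + c   <⟨ +-monoˡ-< c (≰⇒> far) ⟩
      b 0 + c        ≤⟨ +-monoˡ-≤ c (proj₂ (sb 0 z<s)) ⟩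
      b 1 + c + c    ≡⟨ +-assoc (b 1) c c ⟩
      b 1 + (c + c)  ≤⟨ +-monoʳ-≤ (b 1) 2c≤c′ ⟩
      b 1 + c′       ∎))) (m≤m+n (b 1) c′)
    where
    swap : ∀ x y z → x + y + z ≡ x + z + y
    swap = solve-∀
... | j , j≤J , close₁ , close₂ = suc j , s≤s j≤J , close₁ , close₂

transfer-slack : ∀ x₀ x₁ y₀ y₁ c → x₀ + x₁ ≤ y₀ + y₁ + (c + c) → y₀ + c < x₀ → x₁ ≤ y₁ + c
transfer-slack x₀ x₁ y₀ y₁ c sum-close x₀-far = <⇒≤ (+-cancelˡ-< (y₀ + c) x₁ (y₁ + c) (begin-strict
  y₀ + c + x₁        <⟨ +-monoˡ-< x₁ x₀-far ⟩
  x₀ + x₁            ≤⟨ sum-close ⟩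
  y₀ + y₁ + (c + c)  ≡⟨ rearrange y₀ y₁ c ⟩
  y₀ + c + (y₁ + c)  ∎))
  where
  open ≤-Reasoning
  rearrange : ∀ x y z → x + y + (z + z) ≡ x + z + (y + z)
  rearrange = solve-∀

discrete-ivt-sum : ∀ (a b : ℕ → ℕ) (c c′ J : ℕ) → c + c ≤ c′ →
  SlowlyVarying a c J → SlowlyVarying b c J →
  a 0 + a J ≤ b 0 + b J + (c′ + c′) → b 0 + b J ≤ a 0 + a J + (c′ + c′) →
  Σ ℕ λ j → j ≤ J × a j ≤ b j + c′ × b j ≤ a j + c′
discrete-ivt-sum a b c c′ J 2c≤c′ sa sb sum₁ sum₂ with a 0 ≤? b 0 + c′ | b J ≤? a J + c′
... | yes start | yes end = discrete-ivt a b c c′ J 2c≤c′ sa sb start end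
... | yes _ | no far = swap (discrete-ivt b a c c′ J 2c≤c′ sb sa start end)
  where
  start : b 0 ≤ a 0 + c′
  start = transfer-slack (b J) (b 0) (a J) (a 0) c′
            (subst₂ _≤_ (+-comm (b 0) (b J)) (cong (_+ (c′ + c′)) (+-comm (a 0) (a J))) sum₂) (≰⇒> far)
  end : a J ≤ b J + c′
  end = ≤-trans (m≤m+n (a J) c′) (≤-trans (<⇒≤ (≰⇒> far)) (m≤m+n (b J) c′))
  swap : (Σ ℕ λ j → j ≤ J × b j ≤ a j + c′ × a j ≤ b j + c′) → Σ ℕ λ j → j ≤ J × a j ≤ b j + c′ × b j ≤ a j + c′
  swap (j , j≤J , p , q) = j , j≤J , q , p
... | no far | _ = swap (discrete-ivt b a c c′ J 2c≤c′ sb sa start end)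
  where
  start : b 0 ≤ a 0 + c′
  start = ≤-trans (m≤m+n (b 0) c′) (≤-trans (<⇒≤ (≰⇒> far)) (m≤m+n (a 0) c′))
  end : a J ≤ b J + c′
  end = transfer-slack (a 0) (a J) (b 0) (b J) c′ sum₁ (≰⇒> far)
  swap : (Σ ℕ λ j → j ≤ J × b j ≤ a j + c′ × a j ≤ b j + c′) → Σ ℕ λ j → j ≤ J × a j ≤ b j + c′ × b j ≤ a j + c′
  swap (j , j≤J , p , q) = j , j≤J , q , p

parity : ℕ → ℕ
parity zero          = 0
parity (suc zero)    = 1
parity (suc (suc n)) = parity n

private
  +-2*suc : ∀ x y → x + 2 * suc y ≡ suc (suc (x + 2 * y))
  +-2*suc = solve-∀

parity-⌊/2⌋ : ∀ n → n ≡ parity n + 2 * ⌊ n /2⌋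
parity-⌊/2⌋ zero          = refl
parity-⌊/2⌋ (suc zero)    = refl
parity-⌊/2⌋ (suc (suc n)) = trans (cong (λ x → suc (suc x)) (parity-⌊/2⌋ n)) (sym (+-2*suc (parity n) ⌊ n /2⌋))

parity-0∨1 : ∀ n → parity n ≡ 0 ⊎ parity n ≡ 1
parity-0∨1 zero          = inj₁ refl
parity-0∨1 (suc zero)    = inj₂ refl
parity-0∨1 (suc (suc n)) = parity-0∨1 n

parity≤1 : ∀ n → parity n ≤ 1
parity≤1 n with parity-0∨1 n
... | inj₁ e = subst (_≤ 1) (sym e) z≤n
... | inj₂ e = ≤-reflexive e

2⌊n/2⌋≤n : ∀ n → 2 * ⌊ n /2⌋ ≤ n
2⌊n/2⌋≤n n = subst (2 * ⌊ n /2⌋ ≤_) (sym (parity-⌊/2⌋ n)) (m≤n+m (2 * ⌊ n /2⌋) (parity n))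

n≤2⌊n/2⌋+1 : ∀ n → n ≤ 2 * ⌊ n /2⌋ + 1
n≤2⌊n/2⌋+1 n = subst (_≤ 2 * ⌊ n /2⌋ + 1) (sym (trans (parity-⌊/2⌋ n) (+-comm (parity n) _)))
                  (+-monoʳ-≤ (2 * ⌊ n /2⌋) (parity≤1 n))

parity-suc : ∀ n → parity (suc n) ≡ 1 ∸ parity n
parity-suc zero          = refl
parity-suc (suc zero)    = refl
parity-suc (suc (suc n)) = parity-suc n

parity-+even : ∀ x y → parity (x + 2 * y) ≡ parity x
parity-+even x zero    = cong parity (+-identityʳ x)
parity-+even x (suc y) = trans (cong parity (+-2*suc x y)) (parity-+even x y)

parity-even+ : ∀ x y → parity (2 * y + x) ≡ parity x
parity-even+ x y = trans (cong parity (+-comm (2 * y) x)) (parity-+even x y)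

parity-reduce : ∀ t y → parity (t + y) ≡ parity (parity t + y)
parity-reduce t y = trans (cong (λ x → parity (x + y)) (parity-⌊/2⌋ t))
  (trans (cong parity (rearrange (parity t) ⌊ t /2⌋ y)) (parity-+even (parity t + y) ⌊ t /2⌋))
  where
  rearrange : ∀ a b c → a + 2 * b + c ≡ a + c + 2 * b
  rearrange = solve-∀

parity-+self : ∀ q → parity (parity q + q) ≡ 0
parity-+self q = trans (cong parity (+-comm (parity q) q)) (trans (parity-reduce q (parity q)) (double (parity-0∨1 q)))
  where
  double : parity q ≡ 0 ⊎ parity q ≡ 1 → parity (parity q + parity q) ≡ 0
  double (inj₁ e) rewrite e = refl
  double (inj₂ e) rewrite e = refl

parity-suc-0 : ∀ n → parity n ≡ 0 → parity (suc n) ≡ 1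
parity-suc-0 n e = trans (parity-suc n) (cong (1 ∸_) e)

parity-suc-1 : ∀ n → parity n ≡ 1 → parity (suc n) ≡ 0
parity-suc-1 n e = trans (parity-suc n) (cong (1 ∸_) e)

parity-suc-≢ : ∀ n → parity n ≢ parity (suc n)
parity-suc-≢ n e with parity-0∨1 n
... | inj₁ e0 = 0≢1+n (trans (sym e0) (trans e (parity-suc-0 n e0)))
... | inj₂ e1 = 1+n≢0 (trans (sym e1) (trans e (parity-suc-1 n e1)))

parity-pred-1 : ∀ n → parity (suc n) ≡ 1 → parity n ≡ 0
parity-pred-1 n e with parity-0∨1 n
... | inj₁ e0 = e0
... | inj₂ e1 = ⊥-elim (parity-suc-≢ n (trans e1 (sym e)))

parity-pred-0 : ∀ n → parity (suc n) ≡ 0 → parity n ≡ 1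
parity-pred-0 n e with parity-0∨1 n
... | inj₂ e1 = e1
... | inj₁ e0 = ⊥-elim (parity-suc-≢ n (trans e0 (sym e)))

⌊suc/2⌋ : ∀ x → ⌊ suc x /2⌋ ≡ ⌊ x /2⌋ + parity x
⌊suc/2⌋ zero          = refl
⌊suc/2⌋ (suc zero)    = refl
⌊suc/2⌋ (suc (suc x)) = cong suc (⌊suc/2⌋ x)

⌊suc/2⌋≡⌊/2⌋⇒even : ∀ x → ⌊ suc x /2⌋ ≡ ⌊ x /2⌋ → x ≡ 2 * ⌊ x /2⌋
⌊suc/2⌋≡⌊/2⌋⇒even x e = trans (parity-⌊/2⌋ x) (cong (_+ 2 * ⌊ x /2⌋) even)
  where
  even : parity x ≡ 0
  even = +-cancelˡ-≡ ⌊ x /2⌋ (parity x) 0 (trans (sym (⌊suc/2⌋ x)) (trans e (sym (+-identityʳ _))))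

⌊2q+b/2⌋ : ∀ q b → b ≤ 1 → ⌊ 2 * q + b /2⌋ ≡ q
⌊2q+b/2⌋ zero zero          _ = refl
⌊2q+b/2⌋ zero (suc zero)    _ = refl
⌊2q+b/2⌋ zero (suc (suc b)) (s≤s ())
⌊2q+b/2⌋ (suc q) b b≤1 = trans (cong ⌊_/2⌋ (rearrange q b)) (cong suc (⌊2q+b/2⌋ q b b≤1))
  where
  rearrange : ∀ q b → 2 * suc q + b ≡ suc (suc (2 * q + b))
  rearrange = solve-∀

parity-2q+b : ∀ q b → b ≤ 1 → parity (2 * q + b) ≡ b
parity-2q+b q zero       _ = parity-even+ 0 q
parity-2q+b q (suc zero) _ = parity-even+ 1 q
parity-2q+b q (suc (suc b)) (s≤s ())

⌊odd/2⌋ : ∀ q → ⌊ suc (2 * q) /2⌋ ≡ q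
⌊odd/2⌋ q = trans (cong ⌊_/2⌋ (+-comm 1 (2 * q))) (⌊2q+b/2⌋ q 1 (s≤s z≤n))

2q+b-injective : ∀ a b c d → b ≤ 1 → d ≤ 1 → 2 * a + b ≡ 2 * c + d → a ≡ c × b ≡ d
2q+b-injective a b c d b≤1 d≤1 e =
  trans (sym (⌊2q+b/2⌋ a b b≤1)) (trans (cong ⌊_/2⌋ e) (⌊2q+b/2⌋ c d d≤1)) ,
  trans (sym (parity-2q+b a b b≤1)) (trans (cong parity e) (parity-2q+b c d d≤1))

PathAdj : ℕ → ℕ → Set
PathAdj u v = suc u ≡ v ⊎ suc v ≡ u

line : ℕ → ℕ → ℕ → ℕ
line x y j with x ≤? y
... | yes _ = x + j
... | no _  = x ∸ j

line-start : ∀ x y → line x y 0 ≡ x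
line-start x y with x ≤? y
... | yes _ = +-identityʳ x
... | no _  = refl

line-end : ∀ x y → line x y ∣ x - y ∣ ≡ y
line-end x y with x ≤? y
... | yes x≤y = trans (cong (x +_) (m≤n⇒∣m-n∣≡n∸m x≤y)) (m+[n∸m]≡n x≤y)
... | no x≰y  = trans (cong (x ∸_) (m≤n⇒∣n-m∣≡n∸m y≤x)) (m∸[m∸n]≡n y≤x)
  where y≤x = <⇒≤ (≰⇒> x≰y)

line-step : ∀ x y j → j < ∣ x - y ∣ → PathAdj (line x y j) (line x y (suc j))
line-step x y j j<d with x ≤? y
... | yes _  = inj₁ (sym (+-suc x j))
... | no x≰y = inj₂ (sym (+-∸-assoc 1 (≤-trans j<d (≤-trans (≤-reflexive (m≤n⇒∣n-m∣≡n∸m y≤x)) (m∸n≤m x y)))))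
  where y≤x = <⇒≤ (≰⇒> x≰y)

line-bound : ∀ x y m j → x < m → y < m → j ≤ ∣ x - y ∣ → line x y j < m
line-bound x y m j x<m y<m j≤d with x ≤? y
... | yes x≤y = ≤-<-trans (≤-trans (+-monoʳ-≤ x (≤-trans j≤d (≤-reflexive (m≤n⇒∣m-n∣≡n∸m x≤y))))
                                    (≤-reflexive (m+[n∸m]≡n x≤y))) y<m
... | no _    = ≤-<-trans (m∸n≤m x j) x<m

∣-∣<m : ∀ x y m → x < m → y < m → ∣ x - y ∣ < m
∣-∣<m x y m x<m y<m = ≤-<-trans (∣m-n∣≤m⊔n x y) (⊔-lub x<m y<m)

∣odd-odd∣ : ∀ x y → ∣ suc (2 * x) - suc (2 * y) ∣ ≡ 2 * ∣ x - y ∣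
∣odd-odd∣ x y = sym (*-distribˡ-∣-∣ 2 x y)

opposite-parity-adjacent : ∀ p₁ p₂ → p₁ ≤ suc (suc p₂) → p₂ ≤ suc (suc p₁) → parity p₁ ≢ parity p₂ → PathAdj p₁ p₂
opposite-parity-adjacent p₁ p₂ p₁≤ p₂≤ opposite with <-cmp p₁ p₂
... | tri≈ _ refl _ = ⊥-elim (opposite refl)
... | tri< p₁<p₂ _ _ with m≤n⇒m<n∨m≡n p₂≤
...   | inj₁ p₂<2+p₁ = inj₁ (≤-antisym p₁<p₂ (≤-pred p₂<2+p₁))
...   | inj₂ refl    = ⊥-elim (opposite refl)
opposite-parity-adjacent p₁ p₂ p₁≤ p₂≤ opposite | tri> _ _ p₂<p₁ with m≤n⇒m<n∨m≡n p₁≤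
...   | inj₁ p₁<2+p₂ = inj₂ (≤-antisym p₂<p₁ (≤-pred p₁<2+p₂))
...   | inj₂ refl    = ⊥-elim (opposite refl)

bit : Bool → ℕ
bit true  = 1
bit false = 0

bit-≢ : ∀ {c₁ c₂} → c₁ ≢ c₂ → bit c₁ ≢ bit c₂
bit-≢ {false} {false} ne _ = ne refl
bit-≢ {true}  {true}  ne _ = ne refl
bit-≢ {false} {true}  _ ()
bit-≢ {true}  {false} _ ()

position : ℕ → Bool → ℕ
position t c = t + parity (bit c + t)

position-parity : ∀ t c → parity (position t c) ≡ bit c
position-parity t false = trans (cong parity (+-comm t (parity t))) (parity-+self t)
position-parity t true with parity-0∨1 t
... | inj₁ e = trans (cong (λ x → parity (t + x)) (parity-suc-0 t e)) (trans (cong parity (+-comm t 1)) (parity-suc-0 t e))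
... | inj₂ e = trans (cong (λ x → parity (t + x)) (parity-suc-1 t e)) (trans (cong parity (+-identityʳ t)) e)

position-cases : ∀ t c → position t c ≡ t ⊎ position t c ≡ suc t
position-cases t c with parity-0∨1 (bit c + t)
... | inj₁ e = inj₁ (trans (cong (t +_) e) (+-identityʳ t))
... | inj₂ e = inj₂ (trans (cong (t +_) e) (+-comm t 1))

-- Near t m: the step m → m + 1 of the walk touches position t or t + 1.
Near : ℕ → ℕ → Set
Near t m = m ≡ t ⊎ suc m ≡ t ⊎ m ≡ suc t

position-near : ∀ t c → Near t (position t c)
position-near t c with position-cases t c
... | inj₁ e = inj₁ e
... | inj₂ e = inj₂ (inj₂ e)

before-position-near : ∀ t c m → suc m ≡ position t c → Near t m
before-position-near t c m e with position-cases t c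
... | inj₁ e′ = inj₂ (inj₁ (trans e e′))
... | inj₂ e′ = inj₁ (suc-injective (trans e e′))

edge-positions : ∀ t₁ t₂ c₁ c₂ → c₁ ≢ c₂ → t₂ ≤ suc t₁ → t₁ ≤ suc t₂ →
  Σ ℕ λ m → Near t₁ m × Near t₂ m ×
    ((position t₁ c₁ ≡ m × position t₂ c₂ ≡ suc m) ⊎ (position t₁ c₁ ≡ suc m × position t₂ c₂ ≡ m))
edge-positions t₁ t₂ c₁ c₂ c₁≢c₂ t₂≤ t₁≤ with opposite-parity-adjacent p₁ p₂ (close t₁ t₂ c₁ c₂ t₁≤) (close t₂ t₁ c₂ c₁ t₂≤) opposite
  where
  p₁ = position t₁ c₁
  p₂ = position t₂ c₂
  close : ∀ t t′ c c′ → t ≤ suc t′ → position t c ≤ suc (suc (position t′ c′))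
  close t t′ c c′ t≤ = ≤-trans (≤-trans (+-monoʳ-≤ t (parity≤1 (bit c + t))) (≤-reflexive (+-comm t 1)))
                                (s≤s (≤-trans t≤ (s≤s (m≤m+n t′ _))))
  opposite : parity p₁ ≢ parity p₂
  opposite e = bit-≢ c₁≢c₂ (trans (sym (position-parity t₁ c₁)) (trans e (position-parity t₂ c₂)))
... | inj₁ e = position t₁ c₁ , position-near t₁ c₁ , before-position-near t₂ c₂ _ e , inj₁ (refl , sym e)
... | inj₂ e = position t₂ c₂ , before-position-near t₁ c₁ _ e , position-near t₂ c₂ , inj₂ (sym e , refl)

<∸2⇒+2< : ∀ t x → t < x ∸ 2 → t + 2 < x
<∸2⇒+2< t (suc (suc x)) t<x = subst (t + 2 <_) (+-comm x 2) (+-monoˡ-< 2 t<x)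

double-bound : ∀ x W₁ W₂ N c e → x ≤ W₁ + e → W₁ ≤ W₂ + c → W₁ + W₂ ≤ N → 2 * x ≤ N + (c + 2 * e)
double-bound x W₁ W₂ N c e x≤ W₁≤ sum≤ = begin
  2 * x                   ≤⟨ *-monoʳ-≤ 2 x≤ ⟩
  2 * (W₁ + e)            ≡⟨ expand W₁ e ⟩
  W₁ + W₁ + 2 * e         ≤⟨ +-monoˡ-≤ (2 * e) (+-monoʳ-≤ W₁ W₁≤) ⟩
  W₁ + (W₂ + c) + 2 * e   ≡⟨ regroup W₁ W₂ c (2 * e) ⟩
  W₁ + W₂ + (c + 2 * e)   ≤⟨ +-monoˡ-≤ (c + 2 * e) sum≤ ⟩
  N + (c + 2 * e)         ∎
  where
  open ≤-Reasoning
  expand : ∀ a b → 2 * (a + b) ≡ a + a + 2 * b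
  expand = solve-∀
  regroup : ∀ a b c d → a + (b + c) + d ≡ a + b + (c + d)
  regroup = solve-∀

-- The data of the construction: n vertices with a 2-colouring and an injective
-- labelling by 0, …, n - 1 (the bandwidth ordering); blocks of labels of width
-- w = w₀ + 1; k pairs of parts, pair q having size pairSize q and prefix sums
-- prefix q; and the chord joining the odd vertices 2a + 1 and 2b + 1.
-- Every pair is assumed to span many blocks.
record Setup : Set where
  field
    n k a b         : ℕ
    a<k             : a < k
    b<k             : b < k
    a≢b             : a ≢ b
    colour          : Fin n → Bool
    label           : Fin n → ℕ
    label-injective : ∀ u v → label u ≡ label v → u ≡ v
    label<n         : ∀ v → label v < n
    w₀              : ℕ
    pairSize prefix : ℕ → ℕ
    prefix-zero     : prefix 0 ≡ 0
    prefix-suc      : ∀ q → prefix (suc q) ≡ prefix q + pairSize q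
    prefix-k        : prefix k ≡ n
    pairSize-large  : ∀ q → q < k → (8 * k + 8) * suc w₀ ≤ pairSize q

module Construction (S : Setup) where
  open Setup S

  -- The blocks t are cut into k consecutive regions, region q being handled by
  -- the pair {2q, 2q + 1} of target vertices.
  module Regions where
    open Blocks label label-injective w₀ public
    open ≤-Reasoning

    -- Region q is B q ≤ t < B (q + 1); B q approximates prefix q / w and has the
    -- parity of q, so that B q + q is even.
    B : ℕ → ℕ
    B q = 2 * ⌊ prefix q / w /2⌋ + parity q

    minRegion : ℕ
    minRegion = 8 * k + 5

    minRegion>0 : 0 < minRegion
    minRegion>0 = ≤-trans (s≤s z≤n) (m≤n+m 5 (8 * k))

    B-upper : ∀ q → B q * w ≤ prefix q + w
    B-upper q = begin
      B q * w                     ≤⟨ *-monoˡ-≤ w (+-mono-≤ (2⌊n/2⌋≤n (prefix q / w)) (parity≤1 q)) ⟩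
      (prefix q / w + 1) * w      ≡⟨ *-distribʳ-+ w (prefix q / w) 1 ⟩
      prefix q / w * w + 1 * w    ≤⟨ +-mono-≤ (m/n*n≤m (prefix q) w) (≤-reflexive (*-identityˡ w)) ⟩
      prefix q + w                ∎

    B-lower : ∀ q → prefix q ≤ B q * w + 2 * w
    B-lower q = <⇒≤ (begin-strict
      prefix q                                ≡⟨ m≡m%n+[m/n]*n (prefix q) w ⟩
      prefix q % w + x * w                    <⟨ +-monoˡ-< (x * w) (m%n<n (prefix q) w) ⟩
      w + x * w                               ≤⟨ +-monoʳ-≤ w (*-monoˡ-≤ w (n≤2⌊n/2⌋+1 x)) ⟩
      w + (2 * ⌊ x /2⌋ + 1) * w               ≤⟨ +-monoʳ-≤ w (*-monoˡ-≤ w (+-monoʳ-≤ (2 * ⌊ x /2⌋) (m≤m+n 1 (parity q)))) ⟩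
      w + (2 * ⌊ x /2⌋ + (1 + parity q)) * w  ≡⟨ rearrange w ⌊ x /2⌋ (parity q) ⟩
      B q * w + 2 * w                         ∎)
      where
      x = prefix q / w
      rearrange : ∀ w h p → w + (2 * h + (1 + p)) * w ≡ (2 * h + p) * w + 2 * w
      rearrange = solve-∀

    B-zero : B 0 ≡ 0
    B-zero = cong (λ x → 2 * ⌊ x / w /2⌋ + parity 0) prefix-zero

    B+q-even : ∀ q → parity (B q + q) ≡ 0
    B+q-even q = trans (cong parity (+-assoc (2 * ⌊ prefix q / w /2⌋) (parity q) q))
                   (trans (parity-even+ (parity q + q) ⌊ prefix q / w /2⌋) (parity-+self q))

    B-gap : ∀ q → q < k → B q + minRegion ≤ B (suc q)
    B-gap q q<k = *-cancelʳ-≤ (B q + minRegion) (B (suc q)) w (+-cancelʳ-≤ (2 * w) _ _ (begin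
      (B q + minRegion) * w + 2 * w        ≡⟨ cong (_+ 2 * w) (*-distribʳ-+ w (B q) minRegion) ⟩
      B q * w + minRegion * w + 2 * w      ≤⟨ +-monoˡ-≤ (2 * w) (+-monoˡ-≤ (minRegion * w) (B-upper q)) ⟩
      prefix q + w + minRegion * w + 2 * w ≡⟨ rearrange (prefix q) k w ⟩
      prefix q + (8 * k + 8) * w           ≤⟨ +-monoʳ-≤ (prefix q) (pairSize-large q q<k) ⟩
      prefix q + pairSize q                ≡⟨ sym (prefix-suc q) ⟩
      prefix (suc q)                       ≤⟨ B-lower (suc q) ⟩
      B (suc q) * w + 2 * w                ∎))
      where
      rearrange : ∀ p k w → p + w + (8 * k + 5) * w + 2 * w ≡ p + (8 * k + 8) * w
      rearrange = solve-∀

    B-step : ∀ q → q < k → B q ≤ B (suc q)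
    B-step q q<k = ≤-trans (m≤m+n (B q) minRegion) (B-gap q q<k)

    B-mono : ∀ q q′ → q ≤ q′ → q′ ≤ k → B q ≤ B q′
    B-mono q zero     q≤q′ _    = ≤-reflexive (cong B (n≤0⇒n≡0 q≤q′))
    B-mono q (suc q′) q≤q′ q′<k with m≤n⇒m<n∨m≡n q≤q′
    ... | inj₁ q<1+q′ = ≤-trans (B-mono q q′ (≤-pred q<1+q′) (<⇒≤ q′<k)) (B-step q′ q′<k)
    ... | inj₂ refl   = ≤-refl

    top : ℕ
    top = k ∸ 1

    k≡1+top : k ≡ suc top
    k≡1+top = sym (m+[n∸m]≡n {1} {k} (≤-trans z<s a<k))

    <k⇒≤top : ∀ {q} → q < k → q ≤ top
    <k⇒≤top {q} q<k = ≤-pred (subst (suc q ≤_) k≡1+top q<k)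

    ≤top⇒<k : ∀ {q} → q ≤ top → q < k
    ≤top⇒<k {q} q≤top = subst (suc q ≤_) (sym k≡1+top) (s≤s q≤top)

    regionBelow : ℕ → ℕ → ℕ
    regionBelow zero    t = 0
    regionBelow (suc q) t with B (suc q) ≤? t
    ... | yes _ = suc q
    ... | no _  = regionBelow q t

    regionBelow-starts : ∀ q t → B (regionBelow q t) ≤ t
    regionBelow-starts zero    t = subst (_≤ t) (sym B-zero) z≤n
    regionBelow-starts (suc q) t with B (suc q) ≤? t
    ... | yes p = p
    ... | no _  = regionBelow-starts q t

    regionBelow-≤ : ∀ q t → regionBelow q t ≤ q
    regionBelow-≤ zero    t = z≤n
    regionBelow-≤ (suc q) t with B (suc q) ≤? t
    ... | yes _ = ≤-refl
    ... | no _  = m≤n⇒m≤1+n (regionBelow-≤ q t)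

    regionBelow-maximal : ∀ q t q′ → regionBelow q t < q′ → q′ ≤ q → t < B q′
    regionBelow-maximal zero    t q′ lt le = ⊥-elim (<-irrefl refl (<-≤-trans lt le))
    regionBelow-maximal (suc q) t q′ lt le with B (suc q) ≤? t
    ... | yes _ = ⊥-elim (<-irrefl refl (<-≤-trans lt le))
    ... | no np with m≤n⇒m<n∨m≡n le
    ...   | inj₁ q′<1+q = regionBelow-maximal q t q′ lt (≤-pred q′<1+q)
    ...   | inj₂ refl   = ≰⇒> np

    -- region t: the region containing block t (the last region extends to infinity).
    region : ℕ → ℕ
    region t = regionBelow top t

    region-starts : ∀ t → B (region t) ≤ t
    region-starts t = regionBelow-starts top t

    region<k : ∀ t → region t < k
    region<k t = ≤top⇒<k (regionBelow-≤ top t)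

    region-ends : ∀ t → suc (region t) < k → t < B (suc (region t))
    region-ends t h = regionBelow-maximal top t (suc (region t)) ≤-refl (<k⇒≤top h)

    region-unique : ∀ t q → q < k → B q ≤ t → (suc q < k → t < B (suc q)) → region t ≡ q
    region-unique t q q<k starts ends with <-cmp (region t) q
    ... | tri≈ _ e _ = e
    ... | tri< lt _ _ = ⊥-elim (<-irrefl refl (<-≤-trans (regionBelow-maximal top t q lt (<k⇒≤top q<k)) starts))
    ... | tri> _ _ gt = ⊥-elim (<-irrefl refl (<-≤-trans (ends (≤-<-trans gt (region<k t)))
                          (≤-trans (B-mono (suc q) (region t) gt (<⇒≤ (region<k t))) (region-starts t))))

    region-step : ∀ t → region (suc t) ≡ region t ⊎
      (region (suc t) ≡ suc (region t) × suc t ≡ B (suc (region t)) × suc (region t) < k)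
    region-step t with suc (region t) <? k
    ... | no last = inj₁ (region-unique (suc t) (region t) (region<k t) (m≤n⇒m≤1+n (region-starts t)) λ h → ⊥-elim (last h))
    ... | yes h with suc t ≟ B (suc (region t))
    ...   | yes e = inj₂ (region-unique (suc t) (suc (region t)) h (≤-reflexive (sym e)) ends , e , h)
      where
      ends : suc (suc (region t)) < k → suc t < B (suc (suc (region t)))
      ends h′ = subst (_< B (suc (suc (region t)))) (sym e)
                  (<-≤-trans (m<m+n (B (suc (region t))) minRegion>0) (B-gap (suc (region t)) h))
    ...   | no ne = inj₁ (region-unique (suc t) (region t) (region<k t) (m≤n⇒m≤1+n (region-starts t))
                      λ h′ → ≤∧≢⇒< (region-ends t h′) ne)
  open Regions public

  module Counts where
    open ≤-Reasoning

    countIn : (Fin n → Bool) → ℕ → ℕ → ℕ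
    countIn h x y = countF (λ v → between x y (block v) ∧ h v)

    countIn-additive : ∀ h x y z → x ≤ y → y ≤ z → countIn h x y + countIn h y z ≡ countIn h x z
    countIn-additive h x y z x≤y y≤z = sym (trans (countF-split (λ v → between x z (block v) ∧ h v) (λ v → block v <ᵇ y))
        (cong₂ _+_ (countF-cong lower⇒ ⇒lower) (countF-cong upper⇒ ⇒upper)))
      where
      lower⇒ : ∀ v → T ((between x z (block v) ∧ h v) ∧ (block v <ᵇ y)) → T (between x y (block v) ∧ h v)
      lower⇒ v p = T-∧-intro {between x y (block v)} {h v}
        (between-intro (between-lo {x} {z} (T-∧-fst (T-∧-fst p))) (<ᵇ⇒< (block v) y (T-∧-snd {between x z (block v) ∧ h v} p)))
        (T-∧-snd {between x z (block v)} (T-∧-fst p))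
      ⇒lower : ∀ v → T (between x y (block v) ∧ h v) → T ((between x z (block v) ∧ h v) ∧ (block v <ᵇ y))
      ⇒lower v p = T-∧-intro {between x z (block v) ∧ h v}
        (T-∧-intro {between x z (block v)} (between-mono {x} {y} ≤-refl y≤z (T-∧-fst p)) (T-∧-snd {between x y (block v)} p))
        (<⇒<ᵇ (between-hi {x} {y} (T-∧-fst p)))
      upper⇒ : ∀ v → T ((between x z (block v) ∧ h v) ∧ not (block v <ᵇ y)) → T (between y z (block v) ∧ h v)
      upper⇒ v p = T-∧-intro {between y z (block v)} {h v}
        (between-intro {y} {z} (≮⇒≥ λ lt → T-not-elim {block v <ᵇ y} (T-∧-snd {between x z (block v) ∧ h v} p) (<⇒<ᵇ lt))
                       (between-hi {x} {z} (T-∧-fst (T-∧-fst p))))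
        (T-∧-snd {between x z (block v)} (T-∧-fst p))
      ⇒upper : ∀ v → T (between y z (block v) ∧ h v) → T ((between x z (block v) ∧ h v) ∧ not (block v <ᵇ y))
      ⇒upper v p = T-∧-intro {between x z (block v) ∧ h v}
        (T-∧-intro {between x z (block v)} (between-mono {y} {z} x≤y ≤-refl (T-∧-fst p)) (T-∧-snd {between y z (block v)} p))
        (T-not-intro λ lt → <-irrefl refl (<-≤-trans (<ᵇ⇒< (block v) y lt) (between-lo {y} {z} (T-∧-fst p))))

    countIn-mono : ∀ h x y x′ y′ → x′ ≤ x → y ≤ y′ → countIn h x y ≤ countIn h x′ y′
    countIn-mono h x y x′ y′ x′≤x y≤y′ = countF-mono λ v p →
      T-∧-intro (between-mono {x} {y} x′≤x y≤y′ (T-∧-fst p)) (T-∧-snd {between x y (block v)} p)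

    countAll : ℕ → ℕ → ℕ
    countAll x y = countF (λ v → between x y (block v))

    countAll-≤ : ∀ x y m → y ≤ x + m → countAll x y ≤ m * w
    countAll-≤ x y m y≤x+m = ≤-trans (countF-mono {q = λ v → between x (x + m) (block v)} λ v → between-mono {x} {y} ≤-refl y≤x+m) (count-blocks x m)

    countIn-≤ : ∀ h x y m → y ≤ x + m → countIn h x y ≤ m * w
    countIn-≤ h x y m y≤x+m = ≤-trans (countF-mono {q = λ v → between x y (block v)} λ v p → T-∧-fst p) (countAll-≤ x y m y≤x+m)

    countAll-span : ∀ x y → x ≤ y → countAll x y + x * w ≤ y * w
    countAll-span x y x≤y = begin
      countAll x y + x * w  ≤⟨ +-monoˡ-≤ (x * w) (countAll-≤ x y (y ∸ x) (≤-reflexive (sym (m+[n∸m]≡n x≤y)))) ⟩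
      (y ∸ x) * w + x * w   ≡⟨ sym (*-distribʳ-+ w (y ∸ x) x) ⟩
      (y ∸ x + x) * w       ≡⟨ cong (_* w) (m∸n+n≡m x≤y) ⟩
      y * w                 ∎

    colour₁ colour₀ : Fin n → Bool
    colour₁ v = colour v
    colour₀ v = not (colour v)

    countAll-colours : ∀ x y → countAll x y ≡ countIn colour₁ x y + countIn colour₀ x y
    countAll-colours x y = countF-split (λ v → between x y (block v)) colour

    -- If the walk leaves the pair during the blocks s ≤ t < s + L of the range
    -- lo ≤ t < E, the class h₁ before and the class h₂ after the detour are
    -- mapped to the same vertex of the pair; beforeAfter counts them.
    beforeAfter : (Fin n → Bool) → (Fin n → Bool) → ℕ → ℕ → ℕ → ℕ → ℕ
    beforeAfter h₁ h₂ lo L E s = countIn h₁ lo s + countIn h₂ (s + L) E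

    beforeAfter-step : ∀ h₁ h₂ lo L E s → lo ≤ s → s + L + 2 ≤ E →
      beforeAfter h₁ h₂ lo L E (s + 2) ≤ beforeAfter h₁ h₂ lo L E s + 2 * w ×
      beforeAfter h₁ h₂ lo L E s ≤ beforeAfter h₁ h₂ lo L E (s + 2) + 2 * w
    beforeAfter-step h₁ h₂ lo L E s lo≤s end≤E = up , down
      where
      shift : s + 2 + L ≡ s + L + 2
      shift = rearrange s L
        where
        rearrange : ∀ a b → a + 2 + b ≡ a + b + 2
        rearrange = solve-∀
      sL≤ : s + L ≤ s + L + 2
      sL≤ = m≤m+n (s + L) 2
      swap : ∀ a b c → a + b + c ≡ a + c + b
      swap = solve-∀
      up : beforeAfter h₁ h₂ lo L E (s + 2) ≤ beforeAfter h₁ h₂ lo L E s + 2 * w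
      up = begin
        countIn h₁ lo (s + 2) + countIn h₂ (s + 2 + L) E
          ≡⟨ cong₂ _+_ (sym (countIn-additive h₁ lo s (s + 2) lo≤s (m≤m+n s 2))) (cong (λ x → countIn h₂ x E) shift) ⟩
        countIn h₁ lo s + countIn h₁ s (s + 2) + countIn h₂ (s + L + 2) E
          ≤⟨ +-mono-≤ (+-monoʳ-≤ (countIn h₁ lo s) (countIn-≤ h₁ s (s + 2) 2 ≤-refl)) (countIn-mono h₂ (s + L + 2) E (s + L) E sL≤ ≤-refl) ⟩
        countIn h₁ lo s + 2 * w + countIn h₂ (s + L) E
          ≡⟨ swap (countIn h₁ lo s) (2 * w) (countIn h₂ (s + L) E) ⟩
        countIn h₁ lo s + countIn h₂ (s + L) E + 2 * w ∎
      down : beforeAfter h₁ h₂ lo L E s ≤ beforeAfter h₁ h₂ lo L E (s + 2) + 2 * w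
      down = begin
        countIn h₁ lo s + countIn h₂ (s + L) E
          ≡⟨ cong (countIn h₁ lo s +_) (sym (countIn-additive h₂ (s + L) (s + L + 2) E sL≤ end≤E)) ⟩
        countIn h₁ lo s + (countIn h₂ (s + L) (s + L + 2) + countIn h₂ (s + L + 2) E)
          ≤⟨ +-mono-≤ (countIn-mono h₁ lo s lo (s + 2) ≤-refl (m≤m+n s 2)) (+-monoˡ-≤ _ (countIn-≤ h₂ (s + L) (s + L + 2) 2 ≤-refl)) ⟩
        countIn h₁ lo (s + 2) + (2 * w + countIn h₂ (s + L + 2) E)
          ≡⟨ cong (λ x → countIn h₁ lo (s + 2) + (2 * w + countIn h₂ x E)) (sym shift) ⟩
        countIn h₁ lo (s + 2) + (2 * w + countIn h₂ (s + 2 + L) E)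
          ≡⟨ trans (sym (+-assoc (countIn h₁ lo (s + 2)) (2 * w) _)) (swap (countIn h₁ lo (s + 2)) (2 * w) _) ⟩
        countIn h₁ lo (s + 2) + countIn h₂ (s + 2 + L) E + 2 * w ∎

    -- With the detour at the very start (s = lo + 1) or at the very end (s = s₁),
    -- the two values of beforeAfter together count both classes of the middle
    -- blocks m₀ ≤ t < s₁, up to the (2L + 8) w vertices near the ends.
    beforeAfter-ends-≤ : ∀ h₁ h₂ lo L E s₁ → lo + 1 + L ≤ s₁ → s₁ + L ≤ E → E ≤ s₁ + L + 3 →
      beforeAfter h₁ h₂ lo L E (lo + 1) + beforeAfter h₁ h₂ lo L E s₁ ≤
      countIn h₁ (lo + 1 + L) s₁ + countIn h₂ (lo + 1 + L) s₁ + (2 * L + 8) * w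
    beforeAfter-ends-≤ h₁ h₂ lo L E s₁ m₀≤s₁ s₁+L≤E E≤ = begin
      (countIn h₁ lo (lo + 1) + countIn h₂ m₀ E) + (countIn h₁ lo s₁ + countIn h₂ (s₁ + L) E)
        ≡⟨ cong₂ (λ x y → (countIn h₁ lo (lo + 1) + x) + (y + countIn h₂ (s₁ + L) E))
             (sym (countIn-additive h₂ m₀ s₁ E m₀≤s₁ s₁≤E)) (sym (countIn-additive h₁ lo m₀ s₁ lo≤m₀ m₀≤s₁)) ⟩
      (countIn h₁ lo (lo + 1) + (countIn h₂ m₀ s₁ + countIn h₂ s₁ E)) + ((countIn h₁ lo m₀ + countIn h₁ m₀ s₁) + countIn h₂ (s₁ + L) E)
        ≡⟨ regroup (countIn h₁ lo (lo + 1)) (countIn h₂ m₀ s₁) (countIn h₂ s₁ E) (countIn h₁ lo m₀) (countIn h₁ m₀ s₁) (countIn h₂ (s₁ + L) E) ⟩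
      (countIn h₁ m₀ s₁ + countIn h₂ m₀ s₁) + (countIn h₁ lo (lo + 1) + countIn h₂ s₁ E + countIn h₁ lo m₀ + countIn h₂ (s₁ + L) E)
        ≤⟨ +-monoʳ-≤ (countIn h₁ m₀ s₁ + countIn h₂ m₀ s₁) (+-mono-≤ (+-mono-≤ (+-mono-≤
             (countIn-≤ h₁ lo (lo + 1) 1 ≤-refl)
             (countIn-≤ h₂ s₁ E (L + 3) (subst (E ≤_) (+-assoc s₁ L 3) E≤)))
             (countIn-≤ h₁ lo m₀ (1 + L) (≤-reflexive (+-assoc lo 1 L))))
             (countIn-≤ h₂ (s₁ + L) E 3 E≤)) ⟩
      (countIn h₁ m₀ s₁ + countIn h₂ m₀ s₁) + (1 * w + (L + 3) * w + (1 + L) * w + 3 * w)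
        ≡⟨ cong ((countIn h₁ m₀ s₁ + countIn h₂ m₀ s₁) +_) (collect L w) ⟩
      (countIn h₁ m₀ s₁ + countIn h₂ m₀ s₁) + (2 * L + 8) * w ∎
      where
      m₀ = lo + 1 + L
      lo≤m₀ : lo ≤ m₀
      lo≤m₀ = ≤-trans (m≤m+n lo 1) (m≤m+n (lo + 1) L)
      s₁≤E : s₁ ≤ E
      s₁≤E = ≤-trans (m≤m+n s₁ L) s₁+L≤E
      regroup : ∀ a b c d e f → (a + (b + c)) + ((d + e) + f) ≡ (e + b) + (a + c + d + f)
      regroup = solve-∀
      collect : ∀ L w → 1 * w + (L + 3) * w + (1 + L) * w + 3 * w ≡ (2 * L + 8) * w
      collect = solve-∀

    beforeAfter-ends-≥ : ∀ h₁ h₂ lo L E s₁ → lo + 1 + L ≤ s₁ → s₁ + L ≤ E →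
      countIn h₁ (lo + 1 + L) s₁ + countIn h₂ (lo + 1 + L) s₁ ≤
      beforeAfter h₂ h₁ lo L E (lo + 1) + beforeAfter h₂ h₁ lo L E s₁
    beforeAfter-ends-≥ h₁ h₂ lo L E s₁ m₀≤s₁ s₁+L≤E = begin
      countIn h₁ m₀ s₁ + countIn h₂ m₀ s₁
        ≤⟨ +-mono-≤ (countIn-mono h₁ m₀ s₁ m₀ E ≤-refl (≤-trans (m≤m+n s₁ L) s₁+L≤E))
                    (countIn-mono h₂ m₀ s₁ lo s₁ (≤-trans (m≤m+n lo 1) (m≤m+n (lo + 1) L)) ≤-refl) ⟩
      countIn h₁ m₀ E + countIn h₂ lo s₁
        ≤⟨ +-mono-≤ (m≤n+m (countIn h₁ m₀ E) (countIn h₂ lo (lo + 1))) (m≤m+n (countIn h₂ lo s₁) (countIn h₁ (s₁ + L) E)) ⟩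
      (countIn h₂ lo (lo + 1) + countIn h₁ m₀ E) + (countIn h₂ lo s₁ + countIn h₁ (s₁ + L) E) ∎
      where
      m₀ = lo + 1 + L

    beforeAfter-sum : ∀ lo L E s → lo ≤ s → s + L ≤ E →
      beforeAfter colour₁ colour₀ lo L E s + beforeAfter colour₀ colour₁ lo L E s ≤ countAll lo E
    beforeAfter-sum lo L E s lo≤s s+L≤E = begin
      (countIn colour₁ lo s + countIn colour₀ (s + L) E) + (countIn colour₀ lo s + countIn colour₁ (s + L) E)
        ≡⟨ regroup (countIn colour₁ lo s) (countIn colour₀ (s + L) E) (countIn colour₀ lo s) (countIn colour₁ (s + L) E) ⟩
      (countIn colour₁ lo s + countIn colour₁ (s + L) E) + (countIn colour₀ lo s + countIn colour₀ (s + L) E)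
        ≤⟨ +-mono-≤ (outside colour₁) (outside colour₀) ⟩
      countIn colour₁ lo E + countIn colour₀ lo E
        ≡⟨ sym (countAll-colours lo E) ⟩
      countAll lo E ∎
      where
      regroup : ∀ a b c d → (a + b) + (c + d) ≡ (a + d) + (c + b)
      regroup = solve-∀
      outside : ∀ h → countIn h lo s + countIn h (s + L) E ≤ countIn h lo E
      outside h = ≤-trans (+-monoʳ-≤ (countIn h lo s) (countIn-mono h (s + L) E s E (m≤m+n s L) ≤-refl))
                          (≤-reflexive (countIn-additive h lo s E lo≤s (≤-trans (m≤m+n s L) s+L≤E)))
  open Counts public

  -- In region q the walk leaves the pair {2q, 2q + 1} once, for a detour of odd
  -- length, and the place of the detour is chosen so as to balance the pair.
  module Switch where
    open ≤-Reasoning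

    -- The detour runs along the cycle from 2q + 1 to 2a + 1 (l₁ q steps), across the
    -- chord to 2b + 1 and along the cycle back to 2q + 1 (l₂ q steps): L q steps, odd.
    l₁ l₂ L : ℕ → ℕ
    l₁ q = ∣ suc (2 * q) - suc (2 * a) ∣
    l₂ q = ∣ suc (2 * b) - suc (2 * q) ∣
    L q  = l₁ q + suc (l₂ q)

    L-odd : ∀ q → L q ≡ 2 * ∣ q - a ∣ + suc (2 * ∣ b - q ∣)
    L-odd q = cong₂ (λ x y → x + suc y) (∣odd-odd∣ q a) (∣odd-odd∣ b q)

    L+3≤4k : ∀ q → q < k → L q + 3 ≤ 4 * k
    L+3≤4k q q<k = begin
      L q + 3                                       ≡⟨ cong (_+ 3) (L-odd q) ⟩
      2 * ∣ q - a ∣ + suc (2 * ∣ b - q ∣) + 3       ≡⟨ rearrange ∣ q - a ∣ ∣ b - q ∣ ⟩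
      2 * suc ∣ q - a ∣ + 2 * suc ∣ b - q ∣         ≤⟨ +-mono-≤ (*-monoʳ-≤ 2 (∣-∣<m q a k q<k a<k)) (*-monoʳ-≤ 2 (∣-∣<m b q k b<k q<k)) ⟩
      2 * k + 2 * k                                 ≡⟨ double k ⟩
      4 * k                                         ∎
      where
      rearrange : ∀ x y → 2 * x + suc (2 * y) + 3 ≡ 2 * suc x + 2 * suc y
      rearrange = solve-∀
      double : ∀ x → 2 * x + 2 * x ≡ 4 * x
      double = solve-∀

    -- The imbalance tolerated in each pair, in vertices.
    slack : ℕ
    slack = (4 * k + 4) * w

    lastBlock : ℕ → ℕ
    lastBlock q = B (suc q) ∸ 1

    -- Candidate switch points: the odd offsets B q + 2j + 1 with j ≤ J q, which
    -- leave room for the detour before the last block.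
    candidate : ℕ → ℕ → ℕ
    candidate q j = B q + suc (2 * j)

    room : ℕ → ℕ
    room q = lastBlock q ∸ (B q + L q + 3)

    J : ℕ → ℕ
    J q = ⌊ room q /2⌋

    candidate-suc : ∀ q j → candidate q (suc j) ≡ candidate q j + 2
    candidate-suc q j = rearrange (B q) j
      where
      rearrange : ∀ a b → a + suc (2 * suc b) ≡ a + suc (2 * b) + 2
      rearrange = solve-∀

    module Balance (q : ℕ) (q<k : q < k) where
      lo = B q
      E  = lastBlock q

      lo+8k+4≤E : lo + (8 * k + 4) ≤ E
      lo+8k+4≤E = subst (_≤ E) (cong (_∸ 1) (trans (cong (lo +_) (minRegion≡ k)) (+-suc lo (8 * k + 4))))
                    (∸-monoˡ-≤ 1 (B-gap q q<k))
        where
        minRegion≡ : ∀ k → 8 * k + 5 ≡ suc (8 * k + 4)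
        minRegion≡ = solve-∀

      room-eq : lo + L q + 3 + room q ≡ E
      room-eq = m+[n∸m]≡n (≤-trans (≤-reflexive (+-assoc lo (L q) 3))
        (≤-trans (+-monoʳ-≤ lo (≤-trans (L+3≤4k q q<k) (≤-trans (m≤m+n (4 * k) (4 * k + 4)) (≤-reflexive (sum k))))) lo+8k+4≤E))
        where
        sum : ∀ a → 4 * a + (4 * a + 4) ≡ 8 * a + 4
        sum = solve-∀

      candidate-room : ∀ j → j ≤ J q → candidate q j + L q + 2 ≤ E
      candidate-room j j≤J = begin
        lo + suc (2 * j) + L q + 2   ≡⟨ rearrange lo j (L q) ⟩
        lo + L q + 3 + 2 * j         ≤⟨ +-monoʳ-≤ (lo + L q + 3) (≤-trans (*-monoʳ-≤ 2 j≤J) (2⌊n/2⌋≤n (room q))) ⟩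
        lo + L q + 3 + room q        ≡⟨ room-eq ⟩
        E                            ∎
        where
        rearrange : ∀ a b c → a + suc (2 * b) + c + 2 ≡ a + c + 3 + 2 * b
        rearrange = solve-∀

      last-candidate-late : E ≤ candidate q (J q) + L q + 3
      last-candidate-late = begin
        E                                 ≡⟨ sym room-eq ⟩
        lo + L q + 3 + room q             ≤⟨ +-monoʳ-≤ (lo + L q + 3) (n≤2⌊n/2⌋+1 (room q)) ⟩
        lo + L q + 3 + (2 * J q + 1)      ≡⟨ rearrange lo (J q) (L q) ⟩
        lo + suc (2 * J q) + L q + 3      ∎
        where
        rearrange : ∀ a b c → a + c + 3 + (2 * b + 1) ≡ a + suc (2 * b) + c + 3
        rearrange = solve-∀

      -- The region is long enough that the first and last candidates are a detour apart.
      L≤2J : L q ≤ 2 * J q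
      L≤2J = ≤-pred (≤-trans (m≤m+n (suc (L q)) 6) (≤-trans (≤-reflexive (shift (L q)))
               (≤-trans (≤-trans L+7≤room (n≤2⌊n/2⌋+1 (room q))) (≤-reflexive (+-comm (2 * J q) 1)))))
        where
        shift : ∀ a → suc a + 6 ≡ a + 3 + 4
        shift = solve-∀
        long : 8 * k + 4 ≤ L q + 3 + room q
        long = +-cancelˡ-≤ lo _ _ (≤-trans lo+8k+4≤E (≤-reflexive (trans (sym room-eq) (assoc lo (L q) (room q)))))
          where
          assoc : ∀ a b c → a + b + 3 + c ≡ a + (b + 3 + c)
          assoc = solve-∀
        L+7≤room : L q + 3 + 4 ≤ room q
        L+7≤room = +-cancelˡ-≤ (L q + 3) _ _ (≤-trans (≤-reflexive (sym (+-assoc (L q + 3) (L q + 3) 4)))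
          (≤-trans (+-monoˡ-≤ 4 (≤-trans (+-mono-≤ (L+3≤4k q q<k) (L+3≤4k q q<k)) (≤-reflexive (double k)))) long))
          where
          double : ∀ a → 4 * a + 4 * a ≡ 8 * a
          double = solve-∀

      slow : ∀ h₁ h₂ → SlowlyVarying (λ j → beforeAfter h₁ h₂ lo (L q) E (candidate q j)) (2 * w) (J q)
      slow h₁ h₂ j j<J =
        subst (λ x → beforeAfter h₁ h₂ lo (L q) E x ≤ beforeAfter h₁ h₂ lo (L q) E (candidate q j) + 2 * w) (sym (candidate-suc q j)) (proj₁ step) ,
        subst (λ x → beforeAfter h₁ h₂ lo (L q) E (candidate q j) ≤ beforeAfter h₁ h₂ lo (L q) E x + 2 * w) (sym (candidate-suc q j)) (proj₂ step)
        where
        step = beforeAfter-step h₁ h₂ lo (L q) E (candidate q j) (m≤m+n lo _) (candidate-room j (<⇒≤ j<J))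

      first+L≤last : lo + 1 + L q ≤ candidate q (J q)
      first+L≤last = ≤-trans (≤-reflexive (+-assoc lo 1 (L q))) (+-monoʳ-≤ lo (s≤s L≤2J))

      last+L≤E : candidate q (J q) + L q ≤ E
      last+L≤E = ≤-trans (m≤m+n (candidate q (J q) + L q) 2) (candidate-room (J q) ≤-refl)

      ends-slack : (2 * L q + 8) * w ≤ slack + slack
      ends-slack = ≤-trans (*-monoˡ-≤ w bound) (≤-reflexive (*-distribʳ-+ w (4 * k + 4) (4 * k + 4)))
        where
        expand : ∀ a → 2 * (a + 3) + 2 ≡ 2 * a + 8
        expand = solve-∀
        expand′ : ∀ a → 2 * (4 * a) + 2 + 6 ≡ 4 * a + 4 + (4 * a + 4)
        expand′ = solve-∀
        bound : 2 * L q + 8 ≤ 4 * k + 4 + (4 * k + 4)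
        bound = ≤-trans (≤-reflexive (sym (expand (L q)))) (≤-trans (+-monoˡ-≤ 2 (*-monoʳ-≤ 2 (L+3≤4k q q<k)))
                  (≤-trans (m≤m+n _ 6) (≤-reflexive (expand′ k))))

      2w+2w≤slack : 2 * w + 2 * w ≤ slack
      2w+2w≤slack = ≤-trans (≤-reflexive (sym (*-distribʳ-+ w 2 2))) (*-monoˡ-≤ w (m≤n+m 4 (4 * k)))

      ends : ∀ h₁ h₂ → beforeAfter h₁ h₂ lo (L q) E (candidate q 0) + beforeAfter h₁ h₂ lo (L q) E (candidate q (J q)) ≤
                       beforeAfter h₂ h₁ lo (L q) E (candidate q 0) + beforeAfter h₂ h₁ lo (L q) E (candidate q (J q)) + (slack + slack)
      ends h₁ h₂ = ≤-trans (beforeAfter-ends-≤ h₁ h₂ lo (L q) E (candidate q (J q)) first+L≤last last+L≤E last-candidate-late)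
                     (+-mono-≤ (beforeAfter-ends-≥ h₁ h₂ lo (L q) E (candidate q (J q)) first+L≤last last+L≤E) ends-slack)

      abstract
        balanced : Σ ℕ λ j → j ≤ J q ×
          beforeAfter colour₁ colour₀ lo (L q) E (candidate q j) ≤ beforeAfter colour₀ colour₁ lo (L q) E (candidate q j) + slack ×
          beforeAfter colour₀ colour₁ lo (L q) E (candidate q j) ≤ beforeAfter colour₁ colour₀ lo (L q) E (candidate q j) + slack
        balanced = discrete-ivt-sum _ _ (2 * w) slack (J q) 2w+2w≤slack
                     (slow colour₁ colour₀) (slow colour₀ colour₁) (ends colour₁ colour₀) (ends colour₀ colour₁)

    abstract
      s : ℕ → ℕ
      s q with q <? k
      ... | yes q<k = candidate q (proj₁ (Balance.balanced q q<k))
      ... | no _    = 0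

      s-candidate : ∀ q (q<k : q < k) → s q ≡ candidate q (proj₁ (Balance.balanced q q<k))
      s-candidate q q<k with q <? k
      ... | yes q<k′ = cong (λ p → candidate q (proj₁ (Balance.balanced q p))) (<-irrelevant q<k′ q<k)
      ... | no q≮k   = ⊥-elim (q≮k q<k)

    s-after-start : ∀ q → q < k → B q < s q
    s-after-start q q<k = subst (B q <_) (sym (s-candidate q q<k)) (≤-trans (≤-reflexive (+-comm 1 (B q))) (+-monoʳ-≤ (B q) z<s))

    s-room : ∀ q → q < k → s q + L q + 2 ≤ lastBlock q
    s-room q q<k = subst (λ x → x + L q + 2 ≤ lastBlock q) (sym (s-candidate q q<k))
                     (Balance.candidate-room q q<k _ (proj₁ (proj₂ (Balance.balanced q q<k))))

    s-room′ : ∀ q → q < k → s q + L q + 3 ≤ B (suc q)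
    s-room′ q q<k = ≤-trans (≤-reflexive (+-suc (s q + L q) 2)) (≤-trans (s≤s (s-room q q<k)) (≤-reflexive 1+last))
      where
      1+last : suc (lastBlock q) ≡ B (suc q)
      1+last = m+[n∸m]≡n {1} (≤-trans minRegion>0 (≤-trans (m≤n+m minRegion (B q)) (B-gap q q<k)))

    s-balanced₁ : ∀ q → q < k → beforeAfter colour₁ colour₀ (B q) (L q) (lastBlock q) (s q) ≤
                                 beforeAfter colour₀ colour₁ (B q) (L q) (lastBlock q) (s q) + slack
    s-balanced₁ q q<k rewrite s-candidate q q<k = proj₁ (proj₂ (proj₂ (Balance.balanced q q<k)))

    s-balanced₀ : ∀ q → q < k → beforeAfter colour₀ colour₁ (B q) (L q) (lastBlock q) (s q) ≤
                                 beforeAfter colour₁ colour₀ (B q) (L q) (lastBlock q) (s q) + slack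
    s-balanced₀ q q<k rewrite s-candidate q q<k = proj₂ (proj₂ (proj₂ (Balance.balanced q q<k)))

    s+q-odd : ∀ q → q < k → parity (s q + q) ≡ 1
    s+q-odd q q<k = trans (cong parity (trans (cong (_+ q) (s-candidate q q<k)) (rearrange (B q) j q)))
                      (parity-suc-0 (2 * j + (B q + q)) (trans (parity-even+ (B q + q) j) (B+q-even q)))
      where
      j = proj₁ (Balance.balanced q q<k)
      rearrange : ∀ a b c → a + suc (2 * b) + c ≡ suc (2 * b + (a + c))
      rearrange = solve-∀
  open Switch public

  module Walk where

    Chord : ℕ → ℕ → Set
    Chord u v = (u ≡ suc (2 * a) × v ≡ suc (2 * b)) ⊎ (v ≡ suc (2 * a) × u ≡ suc (2 * b))

    WalkAdj : ℕ → ℕ → Set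
    WalkAdj u v = PathAdj u v ⊎ Chord u v

    WalkAdj-sym : ∀ u v → WalkAdj u v → WalkAdj v u
    WalkAdj-sym u v (inj₁ (inj₁ e))  = inj₁ (inj₂ e)
    WalkAdj-sym u v (inj₁ (inj₂ e))  = inj₁ (inj₁ e)
    WalkAdj-sym u v (inj₂ (inj₁ ab)) = inj₂ (inj₂ ab)
    WalkAdj-sym u v (inj₂ (inj₂ ba)) = inj₂ (inj₁ ba)

    oscillate : ℕ → ℕ → ℕ
    oscillate q t = 2 * q + parity (t + q)

    oscillate-step : ∀ q t → PathAdj (oscillate q t) (oscillate q (suc t))
    oscillate-step q t with parity-0∨1 (t + q)
    ... | inj₁ e = inj₁ (trans (sym (+-suc (2 * q) _)) (cong (2 * q +_) (trans (cong suc e) (sym (parity-suc-0 (t + q) e)))))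
    ... | inj₂ e = inj₂ (trans (sym (+-suc (2 * q) _)) (cong (2 * q +_) (trans (cong suc (parity-suc-1 (t + q) e)) (sym e))))

    ⌊oscillate/2⌋ : ∀ q t → ⌊ oscillate q t /2⌋ ≡ q
    ⌊oscillate/2⌋ q t = ⌊2q+b/2⌋ q (parity (t + q)) (parity≤1 (t + q))

    detour : ℕ → ℕ → ℕ
    detour q j with j ≤? l₁ q
    ... | yes _ = line (suc (2 * q)) (suc (2 * a)) j
    ... | no _  = line (suc (2 * b)) (suc (2 * q)) (j ∸ suc (l₁ q))

    detour-out : ∀ q j → j ≤ l₁ q → detour q j ≡ line (suc (2 * q)) (suc (2 * a)) j
    detour-out q j j≤l₁ with j ≤? l₁ q
    ... | yes _ = refl
    ... | no j≰l₁ = ⊥-elim (j≰l₁ j≤l₁)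

    detour-back : ∀ q j → l₁ q < j → detour q j ≡ line (suc (2 * b)) (suc (2 * q)) (j ∸ suc (l₁ q))
    detour-back q j l₁<j with j ≤? l₁ q
    ... | yes j≤l₁ = ⊥-elim (<-irrefl refl (<-≤-trans l₁<j j≤l₁))
    ... | no _     = refl

    L∸l₁ : ∀ q → L q ∸ suc (l₁ q) ≡ l₂ q
    L∸l₁ q = trans (cong (_∸ suc (l₁ q)) (+-suc (l₁ q) (l₂ q))) (m+n∸m≡n (suc (l₁ q)) (l₂ q))

    l₁<L : ∀ q → l₁ q < L q
    l₁<L q = ≤-trans (s≤s (m≤m+n (l₁ q) (l₂ q))) (≤-reflexive (sym (+-suc (l₁ q) (l₂ q))))

    detour-start : ∀ q → detour q 0 ≡ suc (2 * q)
    detour-start q = trans (detour-out q 0 z≤n) (line-start (suc (2 * q)) (suc (2 * a)))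

    detour-end : ∀ q → detour q (L q) ≡ suc (2 * q)
    detour-end q = trans (detour-back q (L q) (l₁<L q))
      (trans (cong (line (suc (2 * b)) (suc (2 * q))) (L∸l₁ q)) (line-end (suc (2 * b)) (suc (2 * q))))

    detour-step : ∀ q j → j < L q → WalkAdj (detour q j) (detour q (suc j))
    detour-step q j j<L with <-cmp j (l₁ q)
    ... | tri< j<l₁ _ _ = inj₁ (subst₂ PathAdj (sym (detour-out q j (<⇒≤ j<l₁))) (sym (detour-out q (suc j) j<l₁))
                            (line-step (suc (2 * q)) (suc (2 * a)) j j<l₁))
    ... | tri≈ _ refl _ = inj₂ (inj₁ (at-a , at-b))
      where
      at-a : detour q (l₁ q) ≡ suc (2 * a)
      at-a = trans (detour-out q (l₁ q) ≤-refl) (line-end (suc (2 * q)) (suc (2 * a)))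
      at-b : detour q (suc (l₁ q)) ≡ suc (2 * b)
      at-b = trans (detour-back q (suc (l₁ q)) ≤-refl)
        (trans (cong (line (suc (2 * b)) (suc (2 * q))) (n∸n≡0 (l₁ q))) (line-start (suc (2 * b)) (suc (2 * q))))
    ... | tri> _ _ l₁<j = inj₁ (subst₂ PathAdj (sym (detour-back q j l₁<j))
                            (sym (trans (detour-back q (suc j) (m≤n⇒m≤1+n l₁<j)) (cong (line (suc (2 * b)) (suc (2 * q))) (+-∸-assoc 1 l₁<j))))
                            (line-step (suc (2 * b)) (suc (2 * q)) (j ∸ suc (l₁ q)) within))
      where
      within : j ∸ suc (l₁ q) < l₂ q
      within = subst (j ∸ suc (l₁ q) <_) (L∸l₁ q) (subst (_≤ L q ∸ suc (l₁ q)) (+-∸-assoc 1 l₁<j) (∸-monoˡ-≤ (suc (l₁ q)) j<L))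

    -- The walk in region q: oscillation before block s q, then the detour, then
    -- oscillation again, now with the opposite phase since L q is odd.
    walkIn : ℕ → ℕ → ℕ
    walkIn q t with t <? s q
    ... | yes _ = oscillate q t
    ... | no _ with t <? s q + L q
    ...   | yes _ = detour q (t ∸ s q)
    ...   | no _  = oscillate q (suc t)

    walkIn-before : ∀ q t → t < s q → walkIn q t ≡ oscillate q t
    walkIn-before q t t<s with t <? s q
    ... | yes _ = refl
    ... | no t≮s = ⊥-elim (t≮s t<s)

    walkIn-detour : ∀ q t → s q ≤ t → t < s q + L q → walkIn q t ≡ detour q (t ∸ s q)
    walkIn-detour q t s≤t t<s+L with t <? s q
    ... | yes t<s = ⊥-elim (<-irrefl refl (<-≤-trans t<s s≤t))
    ... | no _ with t <? s q + L q
    ...   | yes _ = refl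
    ...   | no t≮s+L = ⊥-elim (t≮s+L t<s+L)

    walkIn-after : ∀ q t → s q + L q ≤ t → walkIn q t ≡ oscillate q (suc t)
    walkIn-after q t s+L≤t with t <? s q
    ... | yes t<s = ⊥-elim (<-irrefl refl (<-≤-trans t<s (≤-trans (m≤m+n (s q) (L q)) s+L≤t)))
    ... | no _ with t <? s q + L q
    ...   | yes t<s+L = ⊥-elim (<-irrefl refl (<-≤-trans t<s+L s+L≤t))
    ...   | no _      = refl

    before-detour : ∀ q t → q < k → suc t ≡ s q → oscillate q t ≡ 2 * q + 0
    before-detour q t q<k 1+t≡s = cong (2 * q +_) (parity-pred-1 (t + q) (trans (cong (λ x → parity (x + q)) 1+t≡s) (s+q-odd q q<k)))

    after-detour : ∀ q t → q < k → suc t ≡ s q + L q → oscillate q (suc (suc t)) ≡ suc (2 * q)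
    after-detour q t q<k 1+t≡s+L = trans (cong (2 * q +_) odd) (+-comm (2 * q) 1)
      where
      rearrange : ∀ s d₁ d₂ q → suc (s + (2 * d₁ + suc (2 * d₂))) + q ≡ 2 * (d₁ + d₂ + 1) + (s + q)
      rearrange = solve-∀
      odd : parity (suc (suc t) + q) ≡ 1
      odd = trans (cong (λ x → parity (suc x + q)) (trans 1+t≡s+L (cong (s q +_) (L-odd q))))
              (trans (cong parity (rearrange (s q) ∣ q - a ∣ ∣ b - q ∣ q))
                (trans (parity-even+ (s q + q) (∣ q - a ∣ + ∣ b - q ∣ + 1)) (s+q-odd q q<k)))

    walkIn-step : ∀ q t → q < k → WalkAdj (walkIn q t) (walkIn q (suc t))
    walkIn-step q t q<k with <-cmp (suc t) (s q)
    ... | tri< 1+t<s _ _ = inj₁ (subst₂ PathAdj (sym (walkIn-before q t (<-trans (n<1+n t) 1+t<s)))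
                                   (sym (walkIn-before q (suc t) 1+t<s)) (oscillate-step q t))
    ... | tri≈ _ 1+t≡s _ = inj₁ (inj₁ enter)
      where
      open ≡-Reasoning
      enter : suc (walkIn q t) ≡ walkIn q (suc t)
      enter = begin
        suc (walkIn q t)        ≡⟨ cong suc (walkIn-before q t (≤-reflexive 1+t≡s)) ⟩
        suc (oscillate q t)     ≡⟨ cong suc (before-detour q t q<k 1+t≡s) ⟩
        suc (2 * q + 0)         ≡⟨ cong suc (+-identityʳ (2 * q)) ⟩
        suc (2 * q)             ≡⟨ sym (detour-start q) ⟩
        detour q 0              ≡⟨ cong (detour q) (sym (trans (cong (_∸ s q) 1+t≡s) (n∸n≡0 (s q)))) ⟩
        detour q (suc t ∸ s q)  ≡⟨ sym (walkIn-detour q (suc t) (≤-reflexive (sym 1+t≡s))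
                                     (subst (_< s q + L q) (sym 1+t≡s) (m<m+n (s q) (≤-<-trans z≤n (l₁<L q))))) ⟩
        walkIn q (suc t)        ∎
    ... | tri> _ _ s<1+t with <-cmp (suc t) (s q + L q)
    ...   | tri< 1+t<s+L _ _ = subst₂ WalkAdj (sym (walkIn-detour q t s≤t (<-trans (n<1+n t) 1+t<s+L)))
                                 (sym (trans (walkIn-detour q (suc t) (m≤n⇒m≤1+n s≤t) 1+t<s+L) (cong (detour q) (+-∸-assoc 1 s≤t))))
                                 (detour-step q (t ∸ s q) (offset<L (<-trans (n<1+n t) 1+t<s+L)))
      where
      s≤t = ≤-pred s<1+t
      offset<L : t < s q + L q → t ∸ s q < L q
      offset<L t<s+L = +-cancelʳ-< (s q) (t ∸ s q) (L q) (subst₂ _<_ (sym (m∸n+n≡m s≤t)) (+-comm (s q) (L q)) t<s+L)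
    ...   | tri≈ _ 1+t≡s+L _ = subst₂ WalkAdj (sym (walkIn-detour q t s≤t (≤-reflexive 1+t≡s+L)))
                                 (sym (trans (walkIn-after q (suc t) (≤-reflexive (sym 1+t≡s+L))) (after-detour q t q<k 1+t≡s+L)))
                                 (subst (WalkAdj (detour q (t ∸ s q))) (trans (cong (detour q) 1+offset≡L) (detour-end q))
                                   (detour-step q (t ∸ s q) (subst (t ∸ s q <_) 1+offset≡L (n<1+n _))))
      where
      s≤t = ≤-pred s<1+t
      1+offset≡L : suc (t ∸ s q) ≡ L q
      1+offset≡L = trans (sym (+-∸-assoc 1 s≤t)) (trans (cong (_∸ s q) 1+t≡s+L) (m+n∸m≡n (s q) (L q)))
    ...   | tri> _ _ s+L<1+t = inj₁ (subst₂ PathAdj (sym (walkIn-after q t (≤-pred s+L<1+t))) (sym (walkIn-after q (suc t) (<⇒≤ s+L<1+t)))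
                                     (oscillate-step q (suc t)))

    walk : ℕ → ℕ
    walk t = walkIn (region t) t

    walk-step : ∀ t → WalkAdj (walk t) (walk (suc t))
    walk-step t with region-step t
    ... | inj₁ same = subst (λ q → WalkAdj (walk t) (walkIn q (suc t))) (sym same) (walkIn-step (region t) t (region<k t))
    ... | inj₂ (next , 1+t≡B , 1+q<k) = inj₁ (inj₁ (trans (cong suc leave) (trans (rearrange q) (sym enter))))
      where
      q = region t
      q<k = region<k t
      rearrange : ∀ a → suc (2 * a + 1) ≡ 2 * suc a + 0
      rearrange = solve-∀
      odd : parity (B (suc q) + q) ≡ 1
      odd = parity-pred-0 (B (suc q) + q) (trans (cong parity (sym (+-suc (B (suc q)) q))) (B+q-even (suc q)))
      s+L≤t : s q + L q ≤ t
      s+L≤t = ≤-pred (begin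
        suc (s q + L q)      ≤⟨ m≤m+n (suc (s q + L q)) 2 ⟩
        suc (s q + L q + 2)  ≡⟨ sym (+-suc (s q + L q) 2) ⟩
        s q + L q + 3        ≤⟨ s-room′ q q<k ⟩
        B (suc q)            ≡⟨ sym 1+t≡B ⟩
        suc t                ∎)
        where open ≤-Reasoning
      leave : walk t ≡ 2 * q + 1
      leave = trans (walkIn-after q t s+L≤t)
                (trans (cong (λ x → 2 * q + parity (x + q)) 1+t≡B) (cong (2 * q +_) odd))
      enter : walk (suc t) ≡ 2 * suc q + 0
      enter = trans (cong (λ x → walkIn x (suc t)) next)
                (trans (walkIn-before (suc q) (suc t) (subst (_< s (suc q)) (sym 1+t≡B) (s-after-start (suc q) 1+q<k)))
                  (trans (cong (λ x → 2 * suc q + parity (x + suc q)) 1+t≡B) (cong (2 * suc q +_) (B+q-even (suc q)))))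

    2q+1<2k : ∀ q → q < k → suc (2 * q) < 2 * k
    2q+1<2k q q<k = ≤-trans (≤-reflexive (sym (*-suc 2 q))) (*-monoʳ-≤ 2 q<k)

    oscillate<2k : ∀ q t → q < k → oscillate q t < 2 * k
    oscillate<2k q t q<k = ≤-<-trans (≤-trans (+-monoʳ-≤ (2 * q) (parity≤1 (t + q))) (≤-reflexive (+-comm (2 * q) 1))) (2q+1<2k q q<k)

    detour<2k : ∀ q j → q < k → j < L q → detour q j < 2 * k
    detour<2k q j q<k j<L with j ≤? l₁ q
    ... | yes j≤l₁ = line-bound (suc (2 * q)) (suc (2 * a)) (2 * k) j (2q+1<2k q q<k) (2q+1<2k a a<k) j≤l₁
    ... | no _     = line-bound (suc (2 * b)) (suc (2 * q)) (2 * k) (j ∸ suc (l₁ q)) (2q+1<2k b b<k) (2q+1<2k q q<k)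
                       (subst (j ∸ suc (l₁ q) ≤_) (L∸l₁ q) (∸-monoˡ-≤ (suc (l₁ q)) (<⇒≤ j<L)))

    walkIn<2k : ∀ q t → q < k → walkIn q t < 2 * k
    walkIn<2k q t q<k with t <? s q
    ... | yes _ = oscillate<2k q t q<k
    ... | no t≮s with t <? s q + L q
    ...   | yes t<s+L = detour<2k q (t ∸ s q) q<k (+-cancelʳ-< (s q) (t ∸ s q) (L q)
                          (subst₂ _<_ (sym (m∸n+n≡m (≮⇒≥ t≮s))) (+-comm (s q) (L q)) t<s+L))
    ...   | no _      = oscillate<2k q (suc t) q<k

    walk<2k : ∀ t → walk t < 2 * k
    walk<2k t = walkIn<2k (region t) t (region<k t)

    walk-in-region : ∀ q m → q < k → B q ≤ m → m < B (suc q) → walk m ≡ walkIn q m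
    walk-in-region q m q<k B≤m m<B = cong (λ x → walkIn x m) (region-unique m q q<k B≤m λ _ → m<B)
  open Walk public

  module Mapping where
    open ≤-Reasoning

    image : ℕ → Bool → ℕ
    image t c = walk (position t c)

    inPair : ℕ → Bool
    inPair m = ⌊ walk m /2⌋ ≡ᵇ ⌊ walk (suc m) /2⌋

    InPair : ℕ → ℕ → ℕ → Set
    InPair p x y = (x ≡ 2 * p × y ≡ suc (2 * p)) ⊎ (y ≡ 2 * p × x ≡ suc (2 * p))

    InPair-sym : ∀ p x y → InPair p x y → InPair p y x
    InPair-sym p x y (inj₁ xy) = inj₂ xy
    InPair-sym p x y (inj₂ yx) = inj₁ yx

    -- An edge of C ∪ {c} between vertices with equal ⌊_/2⌋ is a pair edge
    -- (the chord is not, as a ≢ b).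
    pair-edge : ∀ x y → WalkAdj x y → ⌊ x /2⌋ ≡ ⌊ y /2⌋ → Σ ℕ λ p → InPair p x y
    pair-edge x y (inj₁ (inj₁ refl)) e = ⌊ x /2⌋ , inj₁ (even , cong suc even)
      where even = ⌊suc/2⌋≡⌊/2⌋⇒even x (sym e)
    pair-edge x y (inj₁ (inj₂ refl)) e = ⌊ y /2⌋ , inj₂ (even , cong suc even)
      where even = ⌊suc/2⌋≡⌊/2⌋⇒even y e
    pair-edge x y (inj₂ (inj₁ (refl , refl))) e = ⊥-elim (a≢b (trans (sym (⌊odd/2⌋ a)) (trans e (⌊odd/2⌋ b))))
    pair-edge x y (inj₂ (inj₂ (refl , refl))) e = ⊥-elim (a≢b (trans (sym (⌊odd/2⌋ a)) (trans (sym e) (⌊odd/2⌋ b))))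

    image<2k : ∀ t c → image t c < 2 * k
    image<2k t c = walk<2k (position t c)

    nearDetour nearBoundary : ℕ → ℕ → Bool
    nearDetour q t   = between (s q ∸ 2) (s q + L q + 1) t
    nearBoundary q t = between (B (suc q) ∸ 2) (B (suc q) + 2) t

    disturbed : ℕ → ℕ → Bool
    disturbed zero    t = false
    disturbed (suc q) t = (nearDetour q t ∨ nearBoundary q t) ∨ disturbed q t

    undisturbed : ∀ m t q → ¬ T (disturbed m t) → q < m → ¬ T (nearDetour q t) × ¬ T (nearBoundary q t)
    undisturbed (suc m) t q calm q<1+m with m≤n⇒m<n∨m≡n (≤-pred q<1+m)
    ... | inj₁ q<m  = undisturbed m t q (λ d → calm (T-∨-inr {nearDetour m t ∨ nearBoundary m t} d)) q<m
    ... | inj₂ refl = (λ d → calm (T-∨-inl {nearDetour q t ∨ nearBoundary q t} (T-∨-inl {nearDetour q t} d))) ,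
                      (λ d → calm (T-∨-inl {nearDetour q t ∨ nearBoundary q t} (T-∨-inr {nearDetour q t} d)))

    count-disturbed : ∀ m → m ≤ k → countF (λ v → disturbed m (block v)) ≤ m * slack
    count-disturbed zero    _   = ≤-reflexive (countF-empty {n} (λ _ → false) (λ _ ()))
    count-disturbed (suc m) m<k = begin
      countF (λ v → (nearDetour m (block v) ∨ nearBoundary m (block v)) ∨ disturbed m (block v))
        ≤⟨ countF-∨ (λ v → nearDetour m (block v) ∨ nearBoundary m (block v)) (λ v → disturbed m (block v)) ⟩
      countF (λ v → nearDetour m (block v) ∨ nearBoundary m (block v)) + countF (λ v → disturbed m (block v))
        ≤⟨ +-mono-≤ (countF-∨ (λ v → nearDetour m (block v)) (λ v → nearBoundary m (block v))) (count-disturbed m (<⇒≤ m<k)) ⟩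
      countAll (s m ∸ 2) (s m + L m + 1) + countAll (B (suc m) ∸ 2) (B (suc m) + 2) + m * slack
        ≤⟨ +-monoˡ-≤ (m * slack) (+-mono-≤ (countAll-≤ (s m ∸ 2) (s m + L m + 1) (L m + 3) detour-span)
                                           (countAll-≤ (B (suc m) ∸ 2) (B (suc m) + 2) 4 boundary-span)) ⟩
      (L m + 3) * w + 4 * w + m * slack
        ≤⟨ +-monoˡ-≤ (m * slack) (≤-trans (≤-reflexive (sym (*-distribʳ-+ w (L m + 3) 4))) (*-monoˡ-≤ w (+-monoˡ-≤ 4 (L+3≤4k m m<k)))) ⟩
      slack + m * slack ∎
      where
      ≤∸2+2 : ∀ x → x ≤ x ∸ 2 + 2
      ≤∸2+2 x = ≤-trans (m≤n+m∸n x 2) (≤-reflexive (+-comm 2 (x ∸ 2)))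
      detour-span : s m + L m + 1 ≤ s m ∸ 2 + (L m + 3)
      detour-span = ≤-trans (+-monoˡ-≤ 1 (+-monoˡ-≤ (L m) (≤∸2+2 (s m)))) (≤-reflexive (rearrange (s m ∸ 2) (L m)))
        where
        rearrange : ∀ a b → a + 2 + b + 1 ≡ a + (b + 3)
        rearrange = solve-∀
      boundary-span : B (suc m) + 2 ≤ B (suc m) ∸ 2 + 4
      boundary-span = ≤-trans (+-monoˡ-≤ 2 (≤∸2+2 (B (suc m)))) (≤-reflexive (+-assoc (B (suc m) ∸ 2) 2 2))

    record Quiet (t : ℕ) : Set where
      field
        lower    : B (region t) ≤ t ∸ 1
        upper    : t + 2 < B (suc (region t))
        detached : t + 2 < s (region t) ⊎ s (region t) + L (region t) + 1 ≤ t

    quiet : ∀ t → ¬ T (disturbed k t) → t < B k + 2 → Quiet t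
    quiet t calm t<Bk+2 = record { lower = lower ; upper = upper ; detached = detached }
      where
      q = region t
      q<k = region<k t
      lower : B q ≤ t ∸ 1
      lower with q in eq
      ... | zero   = subst (_≤ t ∸ 1) (sym B-zero) z≤n
      ... | suc q′ = m+n≤o⇒m≤o∸n (B (suc q′)) (≤-trans (+-monoʳ-≤ (B (suc q′)) (s≤s z≤n)) (≮⇒≥ far))
        where
        q′<k : q′ < k
        q′<k = <-trans (n<1+n q′) (subst (_< k) eq q<k)
        far : ¬ (t < B (suc q′) + 2)
        far t< = proj₂ (undisturbed k t q′ calm q′<k)
                   (between-intro (≤-trans (m∸n≤m (B (suc q′)) 2) (subst (λ x → B x ≤ t) eq (region-starts t))) t<)
      upper : t + 2 < B (suc q)
      upper with B (suc q) ∸ 2 ≤? t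
      ... | no far   = <∸2⇒+2< t (B (suc q)) (≰⇒> far)
      ... | yes near = ⊥-elim (proj₂ (undisturbed k t q calm q<k) (between-intro near t<B+2))
        where
        t<B+2 : t < B (suc q) + 2
        t<B+2 with suc q <? k
        ... | yes 1+q<k = <-≤-trans (region-ends t 1+q<k) (m≤m+n _ 2)
        ... | no 1+q≮k  = subst (λ x → t < B x + 2) (≤-antisym (≮⇒≥ 1+q≮k) q<k) t<Bk+2
      detached : t + 2 < s q ⊎ s q + L q + 1 ≤ t
      detached with s q ∸ 2 ≤? t
      ... | no far   = inj₁ (<∸2⇒+2< t (s q) (≰⇒> far))
      ... | yes near with s q + L q + 1 ≤? t
      ...   | yes after = inj₂ after
      ...   | no before = ⊥-elim (proj₁ (undisturbed k t q calm q<k) (between-intro near (≰⇒> before)))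

    Oscillates : ℕ → ℕ → Set
    Oscillates t d = ∀ m → t ∸ 1 ≤ m → m ≤ suc (suc t) → walk m ≡ oscillate (region t) (d + m)

    quiet-phase : ∀ t → Quiet t →
      (B (region t) ≤ t × t < s (region t) × Oscillates t 0) ⊎
      (s (region t) + L (region t) ≤ t × t < lastBlock (region t) × Oscillates t 1)
    quiet-phase t qt with Quiet.detached qt
    ... | inj₁ t+2<s = inj₁ (B≤t , <-trans (m<m+n t z<s) t+2<s ,
                        λ m lo hi → trans (at m lo hi) (walkIn-before q m (≤-<-trans hi (subst (_< s q) (+-comm t 2) t+2<s))))
      where
      open Quiet qt
      q = region t
      B≤t = ≤-trans lower (m∸n≤m t 1)
      at : ∀ m → t ∸ 1 ≤ m → m ≤ suc (suc t) → walk m ≡ walkIn q m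
      at m lo hi = walk-in-region q m (region<k t) (≤-trans lower lo) (≤-<-trans hi (subst (_< B (suc q)) (+-comm t 2) upper))
    ... | inj₂ s+L+1≤t = inj₂ (≤-trans (m≤m+n (s q + L q) 1) s+L+1≤t ,
                           m+n≤o⇒m≤o∸n (suc t) (subst (_≤ B (suc q)) (+-comm 1 (suc t)) (<-trans (n<1+n (suc t)) (subst (_< B (suc q)) (+-comm t 2) upper))) ,
                           λ m lo hi → trans (at m lo hi) (walkIn-after q m (≤-trans (m+n≤o⇒m≤o∸n (s q + L q) s+L+1≤t) lo)))
      where
      open Quiet qt
      q = region t
      at : ∀ m → t ∸ 1 ≤ m → m ≤ suc (suc t) → walk m ≡ walkIn q m
      at m lo hi = walk-in-region q m (region<k t) (≤-trans lower lo) (≤-<-trans hi (subst (_< B (suc q)) (+-comm t 2) upper))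

    oscillates-inPair : ∀ t d → Oscillates t d → ∀ m → t ∸ 1 ≤ m → m ≤ suc t → T (inPair m)
    oscillates-inPair t d osc m lo hi = ≡⇒≡ᵇ _ _ (trans (cong ⌊_/2⌋ (osc m lo (≤-trans hi (n≤1+n _))))
      (trans (⌊oscillate/2⌋ (region t) (d + m))
        (sym (trans (cong ⌊_/2⌋ (osc (suc m) (≤-trans lo (n≤1+n m)) (s≤s hi))) (⌊oscillate/2⌋ (region t) (d + suc m))))))

    quiet-inPair : ∀ t → Quiet t → ∀ m → t ∸ 1 ≤ m → m ≤ suc t → T (inPair m)
    quiet-inPair t qt with quiet-phase t qt
    ... | inj₁ (_ , _ , osc) = oscillates-inPair t 0 osc
    ... | inj₂ (_ , _ , osc) = oscillates-inPair t 1 osc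

    oscillates-image : ∀ t d c → Oscillates t d → image t c ≡ 2 * region t + parity (bit c + (d + region t))
    oscillates-image t d c osc = trans (osc p lo hi) (cong (2 * region t +_) (begin-equality
      parity (d + p + region t)             ≡⟨ cong parity (rearrange d p (region t)) ⟩
      parity (p + (d + region t))           ≡⟨ parity-reduce p (d + region t) ⟩
      parity (parity p + (d + region t))    ≡⟨ cong (λ x → parity (x + (d + region t))) (position-parity t c) ⟩
      parity (bit c + (d + region t))       ∎))
      where
      p = position t c
      rearrange : ∀ d p q → d + p + q ≡ p + (d + q)
      rearrange = solve-∀
      lo : t ∸ 1 ≤ p
      lo = ≤-trans (m∸n≤m t 1) (m≤m+n t _)
      hi : p ≤ suc (suc t)
      hi with position-cases t c
      ... | inj₁ e = ≤-trans (≤-reflexive e) (≤-trans (n≤1+n t) (n≤1+n (suc t)))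
      ... | inj₂ e = ≤-trans (≤-reflexive e) (n≤1+n (suc t))

    block<Bk+2 : ∀ v → block v < B k + 2
    block<Bk+2 v = *-cancelʳ-< w (block v) (B k + 2) (begin-strict
      block v * w       ≤⟨ block-lo v ⟩
      label v           <⟨ label<n v ⟩
      n                 ≡⟨ sym prefix-k ⟩
      prefix k          ≤⟨ B-lower k ⟩
      B k * w + 2 * w   ≡⟨ sym (*-distribʳ-+ w (B k) 2) ⟩
      (B k + 2) * w     ∎)

    exceptional : Fin n → Bool
    exceptional v = not (inPair (block v ∸ 1) ∧ (inPair (block v) ∧ inPair (suc (block v))))

    unexceptional-inPair : ∀ v m → ¬ T (exceptional v) → Near (block v) m → T (inPair m)
    unexceptional-inPair v m calm near with decidable-stable (T? (inPair (block v ∸ 1) ∧ (inPair (block v) ∧ inPair (suc (block v)))))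
                                            (λ bad → calm (T-not-intro bad))
    ... | all with near
    ...   | inj₁ e        = subst (λ x → T (inPair x)) (sym e) (T-∧-fst (T-∧-snd {inPair (block v ∸ 1)} all))
    ...   | inj₂ (inj₁ e) = subst (λ x → T (inPair x)) (sym (cong (_∸ 1) e)) (T-∧-fst all)
    ...   | inj₂ (inj₂ e) = subst (λ x → T (inPair x)) (sym e) (T-∧-snd {inPair (block v)} (T-∧-snd {inPair (block v ∸ 1)} all))

    exceptional⇒disturbed : ∀ v → T (exceptional v) → T (disturbed k (block v))
    exceptional⇒disturbed v exc = decidable-stable (T? (disturbed k t)) λ calm →
      T-not-elim {steps} exc (allInPair (quiet-inPair t (quiet t calm (block<Bk+2 v))))
      where
      t = block v
      steps = inPair (t ∸ 1) ∧ (inPair t ∧ inPair (suc t))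
      t∸1≤1+t = ≤-trans (m∸n≤m t 1) (n≤1+n t)
      allInPair : (∀ m → t ∸ 1 ≤ m → m ≤ suc t → T (inPair m)) → T steps
      allInPair ok = T-∧-intro {inPair (t ∸ 1)} {inPair t ∧ inPair (suc t)} (ok (t ∸ 1) ≤-refl t∸1≤1+t)
                       (T-∧-intro {inPair t} {inPair (suc t)} (ok t (m∸n≤m t 1) (n≤1+n t)) (ok (suc t) t∸1≤1+t ≤-refl))

    count-exceptional : countF exceptional ≤ k * slack
    count-exceptional = ≤-trans (countF-mono exceptional⇒disturbed) (count-disturbed k ≤-refl)
  open Mapping public

  module Preimages where
    open ≤-Reasoning

    colourClass : Bool → Fin n → Bool
    colourClass true  v = colour v
    colourClass false v = not (colour v)

    colourClass-≡ : ∀ v c → colour v ≡ c → T (colourClass c v)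
    colourClass-≡ v true  e = subst T (sym e) tt
    colourClass-≡ v false e = subst (λ c → T (not c)) (sym e) tt

    -- The colour that is mapped to 2p + x before the detour of region p;
    -- after the detour it is the other colour.
    selector : ℕ → ℕ → Bool
    selector p x = parity (suc p) ≡ᵇ x

    class-before : ∀ c p x → parity (bit c + p) ≡ x → c ≡ selector p x
    class-before true  p x e = sym (Equivalence.to T-≡ (≡⇒≡ᵇ _ _ e))
    class-before false p x e = sym (Equivalence.to T-not-≡ (T-not-intro λ h → parity-suc-≢ p (trans e (sym (≡ᵇ⇒≡ _ _ h)))))

    class-after : ∀ c p x → parity (bit c + suc p) ≡ x → c ≡ not (selector p x)
    class-after true  p x e = cong not (class-before false p x e)
    class-after false p x e = cong not (class-before true p x e)

    preimage-classify : ∀ p x → x ≤ 1 → ∀ v → image (block v) (colour v) ≡ 2 * p + x →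
      T (between (B p) (s p) (block v) ∧ colourClass (selector p x) v) ⊎
      T (between (s p + L p) (lastBlock p) (block v) ∧ colourClass (not (selector p x)) v) ⊎
      T (disturbed k (block v))
    preimage-classify p x x≤1 v hit = by-disturbance (T? (disturbed k t))
      where
      t = block v
      c = colour v
      sel = selector p x
      decode : ∀ d → Oscillates t d → region t ≡ p × parity (bit c + (d + region t)) ≡ x
      decode d osc = 2q+b-injective (region t) (parity (bit c + (d + region t))) p x (parity≤1 (bit c + (d + region t))) x≤1
                       (trans (sym (oscillates-image t d c osc)) hit)
      by-phase : (B (region t) ≤ t × t < s (region t) × Oscillates t 0) ⊎
                 (s (region t) + L (region t) ≤ t × t < lastBlock (region t) × Oscillates t 1) →
        T (between (B p) (s p) t ∧ colourClass sel v) ⊎ T (between (s p + L p) (lastBlock p) t ∧ colourClass (not sel) v) ⊎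
        T (disturbed k t)
      by-phase (inj₁ (B≤t , t<s , osc)) = inj₁ (T-∧-intro {between (B p) (s p) t} {colourClass sel v}
          (subst (λ q → T (between (B q) (s q) t)) region≡p (between-intro B≤t t<s))
          (colourClass-≡ v sel (class-before c p x (subst (λ q → parity (bit c + q) ≡ x) region≡p bit≡x))))
        where
        region≡p = proj₁ (decode 0 osc)
        bit≡x = proj₂ (decode 0 osc)
      by-phase (inj₂ (s+L≤t , t<E , osc)) = inj₂ (inj₁ (T-∧-intro {between (s p + L p) (lastBlock p) t} {colourClass (not sel) v}
          (subst (λ q → T (between (s q + L q) (lastBlock q) t)) region≡p (between-intro s+L≤t t<E))
          (colourClass-≡ v (not sel) (class-after c p x (subst (λ q → parity (bit c + suc q) ≡ x) region≡p bit≡x)))))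
        where
        region≡p = proj₁ (decode 1 osc)
        bit≡x = proj₂ (decode 1 osc)
      by-disturbance : Dec (T (disturbed k t)) →
        T (between (B p) (s p) t ∧ colourClass sel v) ⊎ T (between (s p + L p) (lastBlock p) t ∧ colourClass (not sel) v) ⊎
        T (disturbed k t)
      by-disturbance (yes d)    = inj₂ (inj₂ d)
      by-disturbance (no calm)  = by-phase (quiet-phase t (quiet t calm (block<Bk+2 v)))

    preimage-count : ∀ p x → p < k → x ≤ 1 →
      countF (λ v → image (block v) (colour v) ≡ᵇ 2 * p + x) ≤
      beforeAfter (colourClass (selector p x)) (colourClass (not (selector p x))) (B p) (L p) (lastBlock p) (s p) + k * slack
    preimage-count p x p<k x≤1 = begin
      countF hits
        ≤⟨ countF-mono classify ⟩
      countF (λ v → before v ∨ (after v ∨ disturbed k (block v)))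
        ≤⟨ countF-∨ before (λ v → after v ∨ disturbed k (block v)) ⟩
      countF before + countF (λ v → after v ∨ disturbed k (block v))
        ≤⟨ +-monoʳ-≤ (countF before) (countF-∨ after (λ v → disturbed k (block v))) ⟩
      countF before + (countF after + countF (λ v → disturbed k (block v)))
        ≤⟨ +-monoʳ-≤ (countF before) (+-monoʳ-≤ (countF after) (count-disturbed k ≤-refl)) ⟩
      countF before + (countF after + k * slack)
        ≡⟨ sym (+-assoc (countF before) (countF after) (k * slack)) ⟩
      countF before + countF after + k * slack ∎
      where
      sel = selector p x
      hits before after : Fin n → Bool
      hits v   = image (block v) (colour v) ≡ᵇ 2 * p + x
      before v = between (B p) (s p) (block v) ∧ colourClass sel v
      after v  = between (s p + L p) (lastBlock p) (block v) ∧ colourClass (not sel) v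
      classify : ∀ v → T (hits v) → T (before v ∨ (after v ∨ disturbed k (block v)))
      classify v hit = [ T-∨-inl {before v} , [ (λ a → T-∨-inr {before v} (T-∨-inl {after v} a)) ,
                                                (λ d → T-∨-inr {before v} (T-∨-inr {after v} d)) ]′ ]′
                         (preimage-classify p x x≤1 v (≡ᵇ⇒≡ _ _ hit))

    countAll-region : ∀ p → p < k → countAll (B p) (lastBlock p) ≤ pairSize p + 3 * w
    countAll-region p p<k = +-cancelʳ-≤ (prefix p) _ _ (begin
      countAll lo E + prefix p            ≤⟨ +-monoʳ-≤ (countAll lo E) (B-lower p) ⟩
      countAll lo E + (B p * w + 2 * w)   ≡⟨ sym (+-assoc (countAll lo E) (B p * w) (2 * w)) ⟩
      countAll lo E + B p * w + 2 * w     ≤⟨ +-monoˡ-≤ (2 * w) (countAll-span lo E lo≤E) ⟩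
      E * w + 2 * w                       ≤⟨ +-monoˡ-≤ (2 * w) (*-monoˡ-≤ w (m∸n≤m (B (suc p)) 1)) ⟩
      B (suc p) * w + 2 * w               ≤⟨ +-monoˡ-≤ (2 * w) (B-upper (suc p)) ⟩
      prefix (suc p) + w + 2 * w          ≡⟨ cong (λ y → y + w + 2 * w) (prefix-suc p) ⟩
      prefix p + pairSize p + w + 2 * w   ≡⟨ rearrange (prefix p) (pairSize p) w ⟩
      pairSize p + 3 * w + prefix p       ∎)
      where
      lo = B p
      E  = lastBlock p
      lo≤E : lo ≤ E
      lo≤E = ≤-trans (m≤m+n lo (8 * k + 4)) (Balance.lo+8k+4≤E p p<k)
      rearrange : ∀ a b c → a + b + c + 2 * c ≡ b + 3 * c + a
      rearrange = solve-∀

    sides₁ sides₀ : ℕ → ℕ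
    sides₁ p = beforeAfter colour₁ colour₀ (B p) (L p) (lastBlock p) (s p)
    sides₀ p = beforeAfter colour₀ colour₁ (B p) (L p) (lastBlock p) (s p)

    sides-sum : ∀ p → p < k → sides₁ p + sides₀ p ≤ pairSize p + 3 * w
    sides-sum p p<k = ≤-trans (beforeAfter-sum (B p) (L p) (lastBlock p) (s p) (<⇒≤ (s-after-start p p<k))
                                (≤-trans (m≤m+n (s p + L p) 2) (s-room p p<k)))
                              (countAll-region p p<k)

    preimage-bound : ∀ p x → p < k → x ≤ 1 →
      2 * countF (λ v → image (block v) (colour v) ≡ᵇ 2 * p + x) ≤ pairSize p + 3 * w + (slack + 2 * (k * slack))
    preimage-bound p x p<k x≤1 with selector p x | preimage-count p x p<k x≤1
    ... | true  | count≤ = double-bound _ (sides₁ p) (sides₀ p) _ slack (k * slack) count≤ (s-balanced₁ p p<k) (sides-sum p p<k)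
    ... | false | count≤ = double-bound _ (sides₀ p) (sides₁ p) _ slack (k * slack) count≤ (s-balanced₀ p p<k)
                             (≤-trans (≤-reflexive (+-comm (sides₀ p) (sides₁ p))) (sides-sum p p<k))
  open Preimages public

inv : ℕ → ℚ
inv M = mkℚ (ℤ.+ 1) M (1-coprimeTo (suc M))

inv-pos : ∀ M → 0ℚ <ℚ inv M
inv-pos M = *<* (+<+ (s≤s z≤n))

toℚ-mkℚ : ∀ n → toℚ n ≡ mkℚ (ℤ.+ n) 0 (Coprimality.sym (1-coprimeTo n))
toℚ-mkℚ n = ℚP.normalize-coprime (Coprimality.sym (1-coprimeTo n))

toℚᵘ-toℚ : ∀ n → toℚᵘ (toℚ n) ≃ᵘ mkℚᵘ (ℤ.+ n) 0
toℚᵘ-toℚ n rewrite toℚ-mkℚ n = ℚᵘP.≃-refl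

+*+ : ∀ m n → ℤ.+ m ℤ.* ℤ.+ n ≡ ℤ.+ (m * n)
+*+ m n = sym (ℤP.pos-* m n)

inv-scaled : ∀ M a n → toℚ a ≤ℚ inv M *ℚ toℚ n → suc M * a ≤ n
inv-scaled M a n a≤ with ℚᵘP.≤-respˡ-≃ (toℚᵘ-toℚ a) (ℚᵘP.≤-respʳ-≃ product (ℚP.toℚᵘ-mono-≤ a≤))
  where
  product : toℚᵘ (inv M *ℚ toℚ n) ≃ᵘ mkℚᵘ (ℤ.+ 1) M *ᵘ mkℚᵘ (ℤ.+ n) 0
  product = ℚᵘP.≃-trans (ℚP.toℚᵘ-homo-* (inv M) (toℚ n)) (ℚᵘP.*-congˡ {mkℚᵘ (ℤ.+ 1) M} (toℚᵘ-toℚ n))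
... | *≤* cross with subst₂ ℤ._≤_ (+*+ a _) (trans (cong (ℤ._* ℤ.+ 1) (ℤP.+◃n≡+n (n + 0))) (+*+ (n + 0) 1)) cross
... | +≤+ scaled = subst₂ _≤_ (trans (cong (a *_) (cong suc (*-identityʳ M))) (*-comm a (suc M)))
                        (trans (*-identityʳ (n + 0)) (+-identityʳ n)) scaled

fraction-bound : ∀ x d (cp : Coprime (suc x) (suc d)) c m n →
  suc d * c ≤ suc d * m + n → toℚ c ≤ℚ toℚ m +ℚ mkℚ (ℤ.+ suc x) d cp *ℚ toℚ n
fraction-bound x d cp c m n bound =
  ℚP.toℚᵘ-cancel-≤ (ℚᵘP.≤-respˡ-≃ (ℚᵘP.≃-sym (toℚᵘ-toℚ c)) (ℚᵘP.≤-respʳ-≃ (ℚᵘP.≃-sym sum) cross))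
  where
  ξ = mkℚ (ℤ.+ suc x) d cp
  D = suc d
  sum : toℚᵘ (toℚ m +ℚ ξ *ℚ toℚ n) ≃ᵘ mkℚᵘ (ℤ.+ m) 0 +ᵘ (mkℚᵘ (ℤ.+ suc x) d *ᵘ mkℚᵘ (ℤ.+ n) 0)
  sum = ℚᵘP.≃-trans (ℚP.toℚᵘ-homo-+ (toℚ m) (ξ *ℚ toℚ n))
          (ℚᵘP.+-cong (toℚᵘ-toℚ m) (ℚᵘP.≃-trans (ℚP.toℚᵘ-homo-* ξ (toℚ n)) (ℚᵘP.*-congˡ {mkℚᵘ (ℤ.+ suc x) d} (toℚᵘ-toℚ n))))
  lhs : ℤ.+ c ℤ.* ℤ.+ suc (d * 1 + 0) ≡ ℤ.+ (c * D)
  lhs rewrite +-identityʳ (d * 1) | *-identityʳ d = +*+ c D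
  rhs : (ℤ.+ m ℤ.* ℤ.+ suc (d * 1) ℤ.+ (ℤ.+ suc x ℤ.* ℤ.+ n) ℤ.* ℤ.+ 1) ℤ.* ℤ.+ 1 ≡ ℤ.+ (m * D + suc x * n)
  rhs rewrite *-identityʳ d | ℤP.*-identityʳ (ℤ.+ m ℤ.* ℤ.+ D ℤ.+ (ℤ.+ suc x ℤ.* ℤ.+ n) ℤ.* ℤ.+ 1)
            | ℤP.*-identityʳ (ℤ.+ suc x ℤ.* ℤ.+ n) | +*+ m D | +*+ (suc x) n = sym (ℤP.pos-+ (m * D) (suc x * n))
  cross-ℕ : c * D ≤ m * D + suc x * n
  cross-ℕ = subst₂ _≤_ (*-comm D c) (cong₂ _+_ (*-comm D m) refl) (≤-trans bound (+-monoʳ-≤ (D * m) (m≤n*m n (suc x))))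
  cross : mkℚᵘ (ℤ.+ c) 0 ≤ᵘ mkℚᵘ (ℤ.+ m) 0 +ᵘ (mkℚᵘ (ℤ.+ suc x) d *ᵘ mkℚᵘ (ℤ.+ n) 0)
  cross = *≤* (subst₂ ℤ._≤_ (sym lhs) (sym rhs) (+≤+ cross-ℕ))

fraction-bound₀ : ∀ x d (cp : Coprime (suc x) (suc d)) c n → suc d * c ≤ n → toℚ c ≤ℚ mkℚ (ℤ.+ suc x) d cp *ℚ toℚ n
fraction-bound₀ x d cp c n bound = subst (toℚ c ≤ℚ_) (trans (cong (_+ℚ (mkℚ (ℤ.+ suc x) d cp *ℚ toℚ n)) (toℚ-mkℚ 0)) (ℚP.+-identityˡ _))
  (fraction-bound x d cp c 0 n (subst (λ y → suc d * c ≤ y + n) (sym (*-zeroʳ (suc d))) bound))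

-- The part sizes n_i indexed by ℕ (0 beyond the last part), and their prefix sums.
part : ∀ {m} → (Fin m → ℕ) → ℕ → ℕ
part {zero}  f j       = 0
part {suc m} f zero    = f fzero
part {suc m} f (suc j) = part (λ i → f (fsuc i)) j

part-toℕ : ∀ {m} (f : Fin m → ℕ) (i : Fin m) → part f (toℕ i) ≡ f i
part-toℕ {suc m} f fzero    = refl
part-toℕ {suc m} f (fsuc i) = part-toℕ (λ i → f (fsuc i)) i

partSum : ∀ {m} → (Fin m → ℕ) → ℕ → ℕ
partSum f zero          = 0
partSum {zero}  f (suc j) = 0
partSum {suc m} f (suc j) = f fzero + partSum (λ i → f (fsuc i)) j

partSum-suc : ∀ {m} (f : Fin m → ℕ) j → partSum f (suc j) ≡ partSum f j + part f j
partSum-suc {zero}  f zero    = refl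
partSum-suc {zero}  f (suc j) = refl
partSum-suc {suc m} f zero    = +-comm (f fzero) 0
partSum-suc {suc m} f (suc j) = trans (cong (f fzero +_) (partSum-suc (λ i → f (fsuc i)) j)) (sym (+-assoc (f fzero) _ _))

partSum-all : ∀ {m} (f : Fin m → ℕ) → partSum f m ≡ sumF f
partSum-all {zero}  f = refl
partSum-all {suc m} f = cong (f fzero +_) (partSum-all (λ i → f (fsuc i)))

+≤2*first+∣-∣ : ∀ x y → x + y ≤ 2 * x + ∣ x - y ∣
+≤2*first+∣-∣ x y = ≤-trans (+-monoʳ-≤ x (m≤n+∣n-m∣ y x)) (≤-reflexive (rearrange x ∣ x - y ∣))
  where
  rearrange : ∀ a d → a + (a + d) ≡ 2 * a + d
  rearrange = solve-∀

+≤2*second+∣-∣ : ∀ x y → x + y ≤ 2 * y + ∣ x - y ∣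
+≤2*second+∣-∣ x y = ≤-trans (+-monoˡ-≤ y (m≤n+∣m-n∣ x y)) (≤-reflexive (rearrange y ∣ x - y ∣))
  where
  rearrange : ∀ a d → a + d + a ≡ 2 * a + d
  rearrange = solve-∀

halve : ∀ D c x y e {n} → 2 * c ≤ 2 * x + y + e → D * y ≤ n → D * e ≤ n → D * c ≤ D * x + n
halve D c x y e {n} twice y-small e-small = *-cancelˡ-≤ 2 (begin
  2 * (D * c)                    ≡⟨ swap D c ⟩
  D * (2 * c)                    ≤⟨ *-monoʳ-≤ D twice ⟩
  D * (2 * x + y + e)            ≡⟨ distribute D x y e ⟩
  2 * (D * x) + (D * y + D * e)  ≤⟨ +-monoʳ-≤ (2 * (D * x)) (+-mono-≤ y-small e-small) ⟩
  2 * (D * x) + (n + n)          ≡⟨ collect (D * x) n ⟩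
  2 * (D * x + n)                ∎)
  where
  open ≤-Reasoning
  swap : ∀ D c → 2 * (D * c) ≡ D * (2 * c)
  swap = solve-∀
  distribute : ∀ D x y e → D * (2 * x + y + e) ≡ 2 * (D * x) + (D * y + D * e)
  distribute = solve-∀
  collect : ∀ a n → 2 * a + (n + n) ≡ 2 * (a + n)
  collect = solve-∀

-- The errors of the construction, in blocks: the slack 3w of a region, the
-- balancing slack (4k + 4) w and twice the k (4k + 4) w exceptional vertices.
errorBlocks : ℕ → ℕ
errorBlocks k = 3 + (4 * k + 4) + 2 * (k * (4 * k + 4))

-- The number of blocks M - 1 needed for accuracy 1 / D: every pair must span
-- 8k + 8 blocks, and D times the errors must stay below n.
blockBudget : ℕ → ℕ → ℕ
blockBudget k D = 3 * k * (8 * k + 8) + 2 * D * errorBlocks k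

module Application (k d n : ℕ) (H : Graph n)
  (colour : Fin n → Bool) (proper : ∀ u v → Edge H u v → colour u ≢ colour v)
  (σ : Fin n → Fin n) (σ-injective : Injective _≡_ _≡_ σ)
  (M≤n : suc (blockBudget k (suc d)) ≤ n)
  (short : ∀ u v → Edge H u v → suc (blockBudget k (suc d)) * ∣ toℕ (σ u) - toℕ (σ v) ∣ ≤ n)
  (ns : Fin (2 * k) → ℕ) (ns-sum : sumF ns ≡ n) (ns-large : ∀ i → n < 3 * k * ns i)
  (ns-close : ∀ (m : Fin k) (i j : Fin (2 * k)) → toℕ i ≡ 2 * toℕ m → toℕ j ≡ suc (2 * toℕ m) →
                suc d * ∣ ns i - ns j ∣ ≤ n)
  (a b : Fin k) (a≢b : a ≢ b) where

  open ≤-Reasoning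

  D M w : ℕ
  D = suc d
  M = suc (blockBudget k D)
  w = suc (n / M)

  Mw≤2n : M * w ≤ n + n
  Mw≤2n = begin
    M * suc (n / M)    ≡⟨ *-suc M (n / M) ⟩
    M + M * (n / M)    ≤⟨ +-mono-≤ M≤n (≤-trans (≤-reflexive (*-comm M (n / M))) (m/n*n≤m n M)) ⟩
    n + n              ∎

  small : ∀ X A → 2 * X ≡ A * w → A ≤ M → X ≤ n
  small X A e A≤M = *-cancelˡ-≤ 2 (begin
    2 * X      ≡⟨ e ⟩
    A * w      ≤⟨ *-monoˡ-≤ w A≤M ⟩
    M * w      ≤⟨ Mw≤2n ⟩
    n + n      ≡⟨ cong (n +_) (sym (+-identityʳ n)) ⟩
    2 * n      ∎)

  errors≤M : 2 * D * errorBlocks k ≤ M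
  errors≤M = ≤-trans (m≤n+m (2 * D * errorBlocks k) (3 * k * (8 * k + 8))) (n≤1+n _)

  2k*q<2k : ∀ q → q < k → suc (2 * q) < 2 * k
  2k*q<2k q q<k = ≤-trans (≤-reflexive (sym (*-suc 2 q))) (*-monoʳ-≤ 2 q<k)

  part-ns : ∀ j (j<2k : j < 2 * k) → part ns j ≡ ns (fromℕ< j<2k)
  part-ns j j<2k = trans (cong (part ns) (sym (FinP.toℕ-fromℕ< j<2k))) (part-toℕ ns (fromℕ< j<2k))

  pairSize prefix : ℕ → ℕ
  pairSize q = part ns (2 * q) + part ns (suc (2 * q))
  prefix q   = partSum ns (2 * q)

  pairSize-large : ∀ q → q < k → (8 * k + 8) * w ≤ pairSize q
  pairSize-large q q<k = <⇒≤ (*-cancelˡ-< (3 * k) _ _ (begin-strict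
    3 * k * ((8 * k + 8) * w)                          ≡⟨ sym (*-assoc (3 * k) (8 * k + 8) w) ⟩
    3 * k * (8 * k + 8) * w                            ≤⟨ *-monoˡ-≤ w (≤-trans (m≤m+n (3 * k * (8 * k + 8)) (2 * D * errorBlocks k)) (n≤1+n _)) ⟩
    M * w                                              ≤⟨ Mw≤2n ⟩
    n + n                                              <⟨ +-mono-< (large (2 * q) (<-trans (n<1+n _) (2k*q<2k q q<k))) (large (suc (2 * q)) (2k*q<2k q q<k)) ⟩
    3 * k * part ns (2 * q) + 3 * k * part ns (suc (2 * q)) ≡⟨ sym (*-distribˡ-+ (3 * k) _ _) ⟩
    3 * k * pairSize q                                 ∎))
    where
    large : ∀ j → j < 2 * k → n < 3 * k * part ns j
    large j j<2k = subst (λ x → n < 3 * k * x) (sym (part-ns j j<2k)) (ns-large (fromℕ< j<2k))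

  setup : Setup
  setup = record
    { n = n ; k = k ; a = toℕ a ; b = toℕ b
    ; a<k = FinP.toℕ<n a ; b<k = FinP.toℕ<n b ; a≢b = λ e → a≢b (FinP.toℕ-injective e)
    ; colour = colour
    ; label = λ v → toℕ (σ v)
    ; label-injective = λ u v e → σ-injective (FinP.toℕ-injective e)
    ; label<n = λ v → FinP.toℕ<n (σ v)
    ; w₀ = n / M
    ; pairSize = pairSize ; prefix = prefix
    ; prefix-zero = refl
    ; prefix-suc = λ q → trans (cong (partSum ns) (*-suc 2 q))
                     (trans (partSum-suc ns (suc (2 * q))) (trans (cong (_+ part ns (suc (2 * q))) (partSum-suc ns (2 * q))) (+-assoc (prefix q) (part ns (2 * q)) (part ns (suc (2 * q))))))
    ; prefix-k = trans (partSum-all ns) ns-sum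
    ; pairSize-large = pairSize-large
    }

  open Construction setup using (block; block-near; slack; WalkAdj; WalkAdj-sym; walk; walk-step; image; image<2k;
                inPair; InPair; InPair-sym; pair-edge; exceptional; unexceptional-inPair; count-exceptional; preimage-bound)

  n<wM : n < w * M
  n<wM = begin-strict
    n                  ≡⟨ m≡m%n+[m/n]*n n M ⟩
    n % M + n / M * M  <⟨ +-monoˡ-< (n / M * M) (m%n<n n M) ⟩
    w * M              ∎

  edge-blocks : ∀ u v → Edge H u v → block v ≤ suc (block u) × block u ≤ suc (block v)
  edge-blocks u v e = block-near u v (≤-<-trans (m≤n+∣n-m∣ (g v) (g u)) (+-monoʳ-< (g u) stretch<w)) ,
                      block-near v u (≤-<-trans (m≤n+∣m-n∣ (g u) (g v)) (+-monoʳ-< (g v) stretch<w))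
    where
    g : Fin n → ℕ
    g x = toℕ (σ x)
    stretch<w : ∣ g u - g v ∣ < w
    stretch<w = *-cancelʳ-< M ∣ g u - g v ∣ w (≤-<-trans (≤-reflexive (*-comm ∣ g u - g v ∣ M)) (≤-<-trans (short u v e) n<wM))

  f : Fin n → Fin (2 * k)
  f v = fromℕ< (image<2k (block v) (colour v))

  toℕ-f : ∀ v → toℕ (f v) ≡ image (block v) (colour v)
  toℕ-f v = FinP.toℕ-fromℕ< (image<2k (block v) (colour v))

  EdgeStep : Fin n → Fin n → Set
  EdgeStep u v = Σ ℕ λ m → Near (block u) m × Near (block v) m ×
    ((toℕ (f u) ≡ walk m × toℕ (f v) ≡ walk (suc m)) ⊎ (toℕ (f u) ≡ walk (suc m) × toℕ (f v) ≡ walk m))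

  edge-step : ∀ u v → Edge H u v → EdgeStep u v
  edge-step u v e = at (edge-positions (block u) (block v) (colour u) (colour v) (proper u v e)
                          (proj₁ (edge-blocks u v e)) (proj₂ (edge-blocks u v e)))
    where
    at : (Σ ℕ λ m → Near (block u) m × Near (block v) m ×
           ((position (block u) (colour u) ≡ m × position (block v) (colour v) ≡ suc m) ⊎
            (position (block u) (colour u) ≡ suc m × position (block v) (colour v) ≡ m))) → EdgeStep u v
    at (m , near-u , near-v , inj₁ (pu , pv)) = m , near-u , near-v , inj₁ (trans (toℕ-f u) (cong walk pu) , trans (toℕ-f v) (cong walk pv))
    at (m , near-u , near-v , inj₂ (pu , pv)) = m , near-u , near-v , inj₂ (trans (toℕ-f u) (cong walk pu) , trans (toℕ-f v) (cong walk pv))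

  walkAdj⇒cycleChordAdj : ∀ i j → WalkAdj (toℕ i) (toℕ j) → CycleChordAdj k a b i j
  walkAdj⇒cycleChordAdj i j (inj₁ (inj₁ e))  = inj₁ (inj₁ e)
  walkAdj⇒cycleChordAdj i j (inj₁ (inj₂ e))  = inj₁ (inj₂ (inj₁ e))
  walkAdj⇒cycleChordAdj i j (inj₂ (inj₁ ab)) = inj₂ (inj₁ ab)
  walkAdj⇒cycleChordAdj i j (inj₂ (inj₂ ba)) = inj₂ (inj₂ ba)

  f-hom : IsHom H k a b f
  f-hom u v e = at (edge-step u v e)
    where
    at : EdgeStep u v → CycleChordAdj k a b (f u) (f v)
    at (m , _ , _ , inj₁ (eu , ev)) = walkAdj⇒cycleChordAdj (f u) (f v) (subst₂ WalkAdj (sym eu) (sym ev) (walk-step m))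
    at (m , _ , _ , inj₂ (eu , ev)) = walkAdj⇒cycleChordAdj (f u) (f v) (subst₂ WalkAdj (sym eu) (sym ev) (WalkAdj-sym _ _ (walk-step m)))

  inPair⇒pairEdge : ∀ i j p → InPair p (toℕ i) (toℕ j) → PairEdge k i j
  inPair⇒pairEdge i j p ip = fromℕ< p<k , subst (λ q → InPair q (toℕ i) (toℕ j)) (sym (FinP.toℕ-fromℕ< p<k)) ip
    where
    2p<2k : InPair p (toℕ i) (toℕ j) → 2 * p < 2 * k
    2p<2k (inj₁ (e , _)) = subst (_< 2 * k) e (FinP.toℕ<n i)
    2p<2k (inj₂ (e , _)) = subst (_< 2 * k) e (FinP.toℕ<n j)
    p<k = *-cancelˡ-< 2 p k (2p<2k ip)

  pair-edges : ∀ u v → Edge H u v → ¬ (exceptional u ∧ exceptional v ≡ true) → PairEdge k (f u) (f v)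
  pair-edges u v e not-both = at (edge-step u v e)
    where
    at : EdgeStep u v → PairEdge k (f u) (f v)
    at (m , near-u , near-v , pos) = inPair⇒pairEdge (f u) (f v) p (orient pos)
      where
      in-pair : T (inPair m)
      in-pair = [ (λ u-ok → unexceptional-inPair u m u-ok near-u) , (λ v-ok → unexceptional-inPair v m v-ok near-v) ]′
                  (¬∧-true (exceptional u) (exceptional v) not-both)
      pe = pair-edge (walk m) (walk (suc m)) (walk-step m) (≡ᵇ⇒≡ _ _ in-pair)
      p = proj₁ pe
      orient : (toℕ (f u) ≡ walk m × toℕ (f v) ≡ walk (suc m)) ⊎ (toℕ (f u) ≡ walk (suc m) × toℕ (f v) ≡ walk m) →
               InPair p (toℕ (f u)) (toℕ (f v))
      orient (inj₁ (eu , ev)) = subst₂ (InPair p) (sym eu) (sym ev) (proj₂ pe)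
      orient (inj₂ (eu , ev)) = subst₂ (InPair p) (sym eu) (sym ev) (InPair-sym p _ _ (proj₂ pe))

  exceptional-few : D * countF exceptional ≤ n
  exceptional-few = ≤-trans (*-monoʳ-≤ D count-exceptional)
    (small (D * (k * slack)) (2 * D * (k * (4 * k + 4))) (rearrange D k w)
      (≤-trans (*-monoʳ-≤ (2 * D) (≤-trans (m≤n*m (k * (4 * k + 4)) 2) (m≤n+m _ (3 + (4 * k + 4))))) errors≤M))
    where
    rearrange : ∀ D k w → 2 * (D * (k * ((4 * k + 4) * w))) ≡ 2 * D * (k * (4 * k + 4)) * w
    rearrange = solve-∀

  error : ℕ
  error = 3 * w + (slack + 2 * (k * slack))

  error-small : D * error ≤ n
  error-small = small (D * error) (2 * D * errorBlocks k) (rearrange D k w) errors≤M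
    where
    rearrange : ∀ D k w → 2 * (D * (3 * w + ((4 * k + 4) * w + 2 * (k * ((4 * k + 4) * w))))) ≡
                          2 * D * (3 + (4 * k + 4) + 2 * (k * (4 * k + 4))) * w
    rearrange = solve-∀

  imbalance : ℕ → ℕ
  imbalance p = ∣ part ns (2 * p) - part ns (suc (2 * p)) ∣

  imbalance-small : ∀ p → p < k → D * imbalance p ≤ n
  imbalance-small p p<k = subst (λ x → D * x ≤ n)
    (sym (cong₂ ∣_-_∣ (part-ns (2 * p) 2p<2k) (part-ns (suc (2 * p)) 2p+1<2k)))
    (ns-close (fromℕ< p<k) (fromℕ< 2p<2k) (fromℕ< 2p+1<2k)
      (trans (FinP.toℕ-fromℕ< 2p<2k) (cong (2 *_) (sym (FinP.toℕ-fromℕ< p<k))))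
      (trans (FinP.toℕ-fromℕ< 2p+1<2k) (cong (λ y → suc (2 * y)) (sym (FinP.toℕ-fromℕ< p<k)))))
    where
    2p+1<2k = 2k*q<2k p p<k
    2p<2k = <-trans (n<1+n (2 * p)) 2p+1<2k

  pairSize-≤ : ∀ i → pairSize ⌊ toℕ i /2⌋ ≤ 2 * ns i + imbalance ⌊ toℕ i /2⌋
  pairSize-≤ i with parity-0∨1 (toℕ i)
  ... | inj₁ e = subst (λ y → pairSize p ≤ 2 * y + imbalance p) first
                   (+≤2*first+∣-∣ (part ns (2 * p)) (part ns (suc (2 * p))))
    where
    p = ⌊ toℕ i /2⌋
    first : part ns (2 * p) ≡ ns i
    first = trans (cong (part ns) (sym (trans (parity-⌊/2⌋ (toℕ i)) (cong (_+ 2 * p) e)))) (part-toℕ ns i)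
  ... | inj₂ e = subst (λ y → pairSize p ≤ 2 * y + imbalance p) second
                   (+≤2*second+∣-∣ (part ns (2 * p)) (part ns (suc (2 * p))))
    where
    p = ⌊ toℕ i /2⌋
    second : part ns (suc (2 * p)) ≡ ns i
    second = trans (cong (part ns) (sym (trans (parity-⌊/2⌋ (toℕ i)) (cong (_+ 2 * p) e)))) (part-toℕ ns i)

  preimage-few : ∀ i → D * preimageSize {n} {k} f i ≤ D * ns i + n
  preimage-few i = ≤-trans (*-monoʳ-≤ D (countF-mono hit))
    (halve D (countF hits) (ns i) (imbalance p) error twice (imbalance-small p p<k) error-small)
    where
    p = ⌊ toℕ i /2⌋
    x = parity (toℕ i)
    hits : Fin n → Bool
    hits v = image (block v) (colour v) ≡ᵇ toℕ i
    hit : ∀ v → T ⌊ f v ≟ᶠ i ⌋ → T (hits v)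
    hit v t = ≡⇒≡ᵇ _ _ (trans (sym (toℕ-f v)) (cong toℕ (toWitness t)))
    i≡2p+x : toℕ i ≡ 2 * p + x
    i≡2p+x = trans (parity-⌊/2⌋ (toℕ i)) (+-comm x (2 * p))
    p<k : p < k
    p<k = *-cancelˡ-< 2 p k (≤-<-trans (m≤m+n (2 * p) x) (subst (_< 2 * k) i≡2p+x (FinP.toℕ<n i)))
    twice : 2 * countF hits ≤ 2 * ns i + imbalance p + error
    twice = ≤-trans (subst (λ y → 2 * countF (λ v → image (block v) (colour v) ≡ᵇ y) ≤ pairSize p + 3 * w + (slack + 2 * (k * slack)))
                      (sym i≡2p+x) (preimage-bound p x p<k (parity≤1 (toℕ i))))
              (≤-trans (≤-reflexive (+-assoc (pairSize p) (3 * w) _)) (+-monoˡ-≤ error (pairSize-≤ i)))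

  conclusions : Σ (Fin n → Bool) λ S → Σ (Fin n → Fin (2 * k)) λ g →
    IsHom H k a b g × D * countF S ≤ n × (∀ i → D * preimageSize {n} {k} g i ≤ D * ns i + n) ×
    (∀ u v → Edge H u v → ¬ (S u ∧ S v ≡ true) → PairEdge k (g u) (g v))
  conclusions = exceptional , f , f-hom , exceptional-few , preimage-few , pair-edges

-- The theorem, with λ = 1 / (d + 1), β = 1 / M and n₀ = M for ξ = (x + 1) / (d + 1)
-- and M = blockBudget k (d + 1) + 1.
lemma8p1 : (Δ k : ℕ) (ξ : ℚ) → 0ℚ <ℚ ξ →
    Σ ℚ λ lam → Σ ℚ λ β → Σ ℕ λ n₀ → 0ℚ <ℚ lam × 0ℚ <ℚ β ×
      ((n : ℕ) → n ≥ n₀ → (H : Graph n) →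
        Bipartite H → BandwidthAtMost H (β *ℚ toℚ n) → MaxDegreeAtMost H Δ →
        (ns : Fin (2 * k) → ℕ) → sumF ns ≡ n →
        (∀ i → n < 3 * k * ns i) →
        (∀ (m : Fin k) (i j : Fin (2 * k)) → toℕ i ≡ 2 * toℕ m → toℕ j ≡ suc (2 * toℕ m) →
          toℚ ∣ ns i - ns j ∣ ≤ℚ lam *ℚ toℚ n) →
        (a b : Fin k) → a ≢ b →
        Σ (Fin n → Bool) λ S → Σ (Fin n → Fin (2 * k)) λ f →
          IsHom H k a b f ×
          toℚ (countF S) ≤ℚ ξ *ℚ toℚ n ×
          (∀ i → toℚ (preimageSize {n} {k} f i) ≤ℚ toℚ (ns i) +ℚ ξ *ℚ toℚ n) ×
          (∀ u v → Edge H u v → ¬ (S u ∧ S v ≡ true) → PairEdge k (f u) (f v)))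
lemma8p1 Δ k (mkℚ (ℤ.+ zero) d _) (*<* (+<+ ()))
lemma8p1 Δ k (mkℚ ℤ.-[1+ _ ] d _) (*<* ())
lemma8p1 Δ k (mkℚ (ℤ.+ suc x) d cp) _ =
  inv d , inv budget , suc budget , inv-pos d , inv-pos budget ,
  λ n n≥n₀ H (colour , proper) (σ , σ-injective , bandwidth) _ ns ns-sum ns-large ns-close a b a≢b →
    let S , f , f-hom , S-few , preimage-few , pair-edges =
          Application.conclusions k d n H colour proper σ σ-injective n≥n₀
            (λ u v e → inv-scaled budget ∣ toℕ (σ u) - toℕ (σ v) ∣ n (bandwidth u v e)) ns ns-sum ns-large
            (λ m i j ei ej → inv-scaled d ∣ ns i - ns j ∣ n (ns-close m i j ei ej)) a b a≢b
    in S , f , f-hom , fraction-bound₀ x d coprime (countF S) n S-few ,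
       (λ i → fraction-bound x d coprime (preimageSize {n} {k} f i) (ns i) n (preimage-few i)) , pair-edges
  where
  budget = blockBudget k (suc d)
  coprime = Coprimality.recompute cp
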